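{- Fix an integer $k\ge1$, let $S_k:=(0,2,2^2,\dots,2^{2k},0)$, and consider only states $F$ with $S_k\mapsto F$ and not $S_{k+1}\mapsto F$. Suppose $E$ is an embanked state such that $N(E)=E[i]$ for some $i\in[0,\ell(E)]$, and suppose $N(E)$ is weakly embanked. Let $h(E)=(h_1,h_2)$. Then $N(E)$ is embanked, and $$N(N(E))=\begin{cases}N(E)[\nu_2(h_1)]& i=0\\ N(E)[\nu_2(h_2+1)+1]& i=1\\ N(E)[i-2]& i\ge2.\end{cases}$$
   Context: A state is a finite tuple of integers $S=(a_\ell,\dots,a_1,a_0)$, $\ell\ge0$; $a_i$ is the $i$-th index (counted from the right starting at 0). The successor $P(S)$: (Overflow) if $a_\ell$ is odd and all other entries even, $P(S)=(0,a_\ell+1,a_{\ell-1},\dots,a_0)$; (Halt) if all entries even and $a_\ell=a_{\ell-1}=0$, the process halts; (Zero) if all entries even and $(a_\ell,a_{\ell-1})\ne(0,0)$, $P(S)=(0,0,a_\ell+1,a_{\ell-1},\dots,a_1,a_0-1)$; (Halve) if $a_0=-1$, $P(S)=(a_\ell,\dots,a_1)$; (Increment) otherwise, with $i$ the smallest index such that $a_i$ is odd, $P(S)=(a_\ell,\dots,a_{i+2},a_{i+1}+1,a_i,\dots,a_1,a_0-1)$. $S\mapsto T$ means $T=P^j(S)$ for some $j\ge0$. For real $r$, $\langle r\rangle$ is the nearest integer, halves rounded up. For a state $S$: $\ell(S)$ = length minus one; $a_i(S)$ its $i$-th entry; $\sigma(S)=+1$ if $\sum_i a_i$ is odd, $-1$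 if even; $n(S)$ is the unique integer $0\le n<2^\ell$ with $\langle n/2^i\rangle\equiv a_i\pmod 2$ for $1\le i\le\ell$. A state $E$ is empty if $n(E)=0$, $\sigma(E)=-1$, and the rule applied at $E$ is not Halt. For empty $E$, $N(E)$ is the first empty state $P^j(E)$, $j\ge1$ (if it exists), and $T_E$ is the sequence of rules applied from $E$ to $N(E)$ (or all rules after $E$ if $N(E)$ does not exist). Empty $E$ is embanked if the rules of $T_E$ other than Increment rules are exactly one Zero rule, at the start, and exactly two Halve rules. Empty $E$ is weakly embanked if $T_E$ begins with Zero, contains at least two Halve rules, and all rules before the second Halve rule other than the initial Zero and the first Halve are Increments. For weakly embanked $E$ and $i\in\{1,2\}$, $h_i(E)$ is the value of $n$ at the state immediately after the $i$-th Halve rule of $T_E$; $h(E)=(h_1(E),h_2(E))$. For $E=(a_\ell,\dots,a_0)$ and $i\in[0,\ell]$, $E[i]:=(a_\ell,\dots,a_{i+1},a_i+2,a_{i-1},\dots,a_0)$. $\nu_2$ denotes the 2-adic valuation. -}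

module Defs where

open import Data.Bool using (Bool; true; false; not; _∧_; if_then_else_)
open import Data.Nat using (ℕ; zero; suc; _+_; _*_; _∸_; _^_; _≤_; _<_; _/_; _%_; _≡ᵇ_)
open import Data.Nat.Properties using (m^n≢0)
open import Data.Nat.Divisibility using (_∣_)
open import Data.Integer using (ℤ; 0ℤ; 1ℤ; -1ℤ; ∣_∣) renaming (_+_ to _+ℤ_; _-_ to _-ℤ_; _≟_ to _≟ℤ_)
open import Data.List using (List; []; _∷_; reverse; length; foldr; drop)
open import Data.Maybe using (Maybe; just; nothing)
open import Data.Product using (Σ; _×_; ∃)
open import Data.Sum using (_⊎_)
open import Relation.Nullary using (¬_)
open import Relation.Nullary.Decidable using (⌊_⌋)
open import Relation.Binary.PropositionalEquality using (_≡_; _≢_)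

-- States.  CONVENTION: a state (a_ℓ, …, a_1, a_0) is stored as the list
-- a_0 ∷ a_1 ∷ … ∷ a_ℓ ∷ []  (head = index 0).  Genuine states are nonempty.

State : Set
State = List ℤ

isOdd : ℤ → Bool
isOdd z = (∣ z ∣ % 2) ≡ᵇ 1

isOddℕ : ℕ → Bool
isOddℕ n = (n % 2) ≡ᵇ 1

allEven : List ℤ → Bool
allEven []       = true
allEven (x ∷ xs) = not (isOdd x) ∧ allEven xs

_==ℤ_ : ℤ → ℤ → Bool
x ==ℤ y = ⌊ x ≟ℤ y ⌋

ell : State → ℕ
ell S = length S ∸ 1

-- i-th entry a_i(S) (0 outside the range, never used there)
entry : State → ℕ → ℤ
entry []       _       = 0ℤ
entry (x ∷ xs) zero    = x
entry (x ∷ xs) (suc i) = entry xs i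

addAt : ℕ → ℤ → List ℤ → List ℤ
addAt _       d []       = []
addAt zero    d (x ∷ xs) = (x +ℤ d) ∷ xs
addAt (suc i) d (x ∷ xs) = x ∷ addAt i d xs

-- smallest index with an odd entry (length if none)
firstOdd : List ℤ → ℕ
firstOdd []       = zero
firstOdd (x ∷ xs) = if isOdd x then zero else suc (firstOdd xs)

data Rule : Set where
  overflow halt zeroR halve increment : Rule

-- the rule applied at a state; rules are tried in the order listed in the paper
ruleRev : State → List ℤ → Rule
ruleRev S []              = halt   -- empty list: not a genuine state
ruleRev S (top ∷ [])      =
  if isOdd top then overflow
  else halt
ruleRev S (top ∷ s ∷ rest) =
  if isOdd top ∧ allEven (s ∷ rest) then overflow
  else if allEven S
       then (if (top ==ℤ 0ℤ) ∧ (s ==ℤ 0ℤ) then halt else zeroR)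
       else (if entry S 0 ==ℤ -1ℤ then halve else increment)

rule : State → Rule
rule S = ruleRev S (reverse S)

onHead : (ℤ → ℤ) → List ℤ → List ℤ
onHead f []       = []
onHead f (x ∷ xs) = f x ∷ xs

-- (a_ℓ,…,a_0) ↦ (0, a_ℓ+1, a_{ℓ-1}, …, a_0)
overflowS : State → State
overflowS S = reverse (0ℤ ∷ onHead (_+ℤ 1ℤ) (reverse S))

-- (a_ℓ,…,a_0) ↦ (0, 0, a_ℓ+1, a_{ℓ-1}, …, a_1, a_0 - 1)
zeroS : State → State
zeroS S = onHead (_-ℤ 1ℤ) (reverse (0ℤ ∷ 0ℤ ∷ onHead (_+ℤ 1ℤ) (reverse S)))

halveS : State → State
halveS S = drop 1 S

incrementS : State → State
incrementS S = addAt 0 -1ℤ (addAt (suc (firstOdd S)) 1ℤ S)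

P : State → Maybe State
P S with rule S
... | overflow  = just (overflowS S)
... | halt      = nothing
... | zeroR     = just (zeroS S)
... | halve     = just (halveS S)
... | increment = just (incrementS S)

iter : ℕ → State → Maybe State
iter zero    S = just S
iter (suc j) S with iter j S
... | nothing = nothing
... | just G  = P G

_↦_ : State → State → Set
S ↦ T = ∃ λ j → iter j S ≡ just T

powsDown : ℕ → List ℤ
powsDown zero    = []
powsDown (suc m) = Data.Integer.+_ (2 ^ suc m) ∷ powsDown m

appendZero : List ℤ → List ℤ
appendZero []       = 0ℤ ∷ []
appendZero (x ∷ xs) = x ∷ appendZero xs

Sk : ℕ → State
Sk k = 0ℤ ∷ appendZero (powsDown (2 * k))

InRange : ℕ → State → Set
InRange k F = (Sk k ↦ F) × ¬ (Sk (suc k) ↦ F)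

sumℤ : List ℤ → ℤ
sumℤ = foldr _+ℤ_ 0ℤ

σ : State → ℤ
σ S = if isOdd (sumℤ S) then 1ℤ else -1ℤ

-- ⟨ n / 2^i ⟩ (nearest integer, halves rounded up) = ⌊ (2n + 2^i) / 2^{i+1} ⌋
roundPow : ℕ → ℕ → ℕ
roundPow n i = _/_ (2 * n + 2 ^ i) (2 ^ suc i) {{m^n≢0 2 (suc i)}}

-- IsN S n  :⇔  n = n(S)  (n(S) is the unique such integer)
IsN : State → ℕ → Set
IsN S n = (n < 2 ^ ell S) ×
          (∀ i → 1 ≤ i → i ≤ ell S → isOddℕ (roundPow n i) ≡ isOdd (entry S i))

Empty : State → Set
Empty E = IsN E 0 × (σ E ≡ -1ℤ) × (rule E ≢ halt)

NextEmpty : State → State → Set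
NextEmpty E F = Σ ℕ λ j → (1 ≤ j) × (iter j E ≡ just F) × Empty F ×
  (∀ j' G → 1 ≤ j' → j' < j → iter j' E ≡ just G → ¬ Empty G)

NoEmptyUpTo : State → ℕ → Set
NoEmptyUpTo E m = ∀ j G → 1 ≤ j → j ≤ m → iter j E ≡ just G → ¬ Empty G

-- TRule E m r : the m-th rule (0-indexed) of the sequence T_E exists and is r
TRule : State → ℕ → Rule → Set
TRule E m r = Σ State λ G → (iter m E ≡ just G) × NoEmptyUpTo E m × (rule G ≡ r)

Embanked : State → Set
Embanked E = Empty E × TRule E 0 zeroR ×
  (Σ ℕ λ p → Σ ℕ λ q → (p < q) × TRule E p halve × TRule E q halve ×
     (∀ m r → 1 ≤ m → TRule E m r →
        (r ≡ increment) ⊎ ((r ≡ halve) × ((m ≡ p) ⊎ (m ≡ q)))))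

WeaklyEmbanked : State → Set
WeaklyEmbanked E = Empty E × TRule E 0 zeroR ×
  (Σ ℕ λ p → Σ ℕ λ q → (p < q) × TRule E p halve × TRule E q halve ×
     (∀ m r → 1 ≤ m → m < q → m ≢ p → TRule E m r → r ≡ increment))

FirstTwoHalves : State → ℕ → ℕ → Set
FirstTwoHalves E p q = (p < q) × TRule E p halve × TRule E q halve ×
  (∀ m → m < q → m ≢ p → ¬ TRule E m halve)

HVal : State → ℕ → ℕ → Set
HVal E h1 h2 = Σ ℕ λ p → Σ ℕ λ q → FirstTwoHalves E p q ×
  (Σ State λ G1 → Σ State λ G2 → (iter (suc p) E ≡ just G1) × (iter (suc q) E ≡ just G2) ×
     IsN G1 h1 × IsN G2 h2)

bump : ℕ → State → State
bump i E = addAt i (Data.Integer.+_ 2) E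

Val2 : ℕ → ℕ → Set
Val2 n v = ((2 ^ v) ∣ n) × ¬ ((2 ^ suc v) ∣ n)

{-# OPTIONS --safe #-}
-- E[i] has the parities of E, and a Halve or Increment depends only on the parities and on whether
-- a_0 = -1.  So the trajectory of F = E[i] shadows that of E with the extra 2 carried along: Zero and
-- Increment leave it in place and each Halve moves it one index down, which for i ≥ 2 ends at F[i-2].
-- For i ≤ 1 the extra 2 is at index 0 when E halves at -1 ∷ Y; the shadow, at 1 ∷ Y, increments
-- twice (the second time because F is weakly embanked), halves, and one Increment later is back on
-- E's trajectory with the extra 2 at index v + 1, v the first odd index of Y with a_0 raised by one.
-- The parities of the entries of Y above a_0 are those of ⟨h/2^i⟩, h = n(Y), which sum to h; so the
-- parity of Y's entry sum decides whether v is ν₂(h) or ν₂(h + 1).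
-- Reachability from S_k keeps every entry ≥ -1.  So an extra 2 at a_0 never makes a_0 = -1, and the
-- (even) entries of empty states are nonnegative, so that the bumped final state does not halt and
-- is empty again.
module Submission where

open import Defs
open import Data.Bool using (Bool; true; false; not; _∧_; _xor_; if_then_else_)
open import Data.Bool.Properties
  using ( not-involutive; not-distribˡ-xor; not-distribʳ-xor; xor-assoc; xor-same; xor-identityʳ
        ; ∧-comm; ∧-identityʳ; ∧-zeroʳ)
open import Data.Empty using (⊥-elim)
open import Data.Integer
  using (ℤ; +_; -[1+_]; 0ℤ; 1ℤ; -1ℤ; +≤+; -≤-; -≤+)
  renaming (_+_ to _+ℤ_; _-_ to _-ℤ_; _≤_ to _≤ℤ_; _≟_ to _≟ℤ_)
import Data.Integer.Properties as ℤ
open import Algebra.Properties.CommutativeSemigroup ℤ.+-commutativeSemigroup using (xy∙z≈xz∙y)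
import Data.Integer.Solver as ℤ-Solver
open import Data.List
  using (List; []; _∷_; _++_; _∷ʳ_; [_]; reverse; length; map; replicate; drop; initLast; _∷ʳ′_)
open import Data.List.Properties
  using (∷-injective; unfold-reverse; length-map; length-++; reverse-++; reverse-involutive; length-replicate)
open import Data.List.Relation.Binary.Pointwise as Pointwise using (Pointwise; []; _∷_)
open import Data.List.Relation.Unary.All as All using (All; []; _∷_)
open import Data.List.Relation.Unary.All.Properties using (++⁺; ++⁻ˡ; ++⁻ʳ; drop⁺)
import Data.List.Relation.Unary.Any.Properties as Any
open import Data.Maybe using (just; nothing; _>>=_)
open import Data.Maybe.Properties using (just-injective)
open import Data.Nat
  using ( ℕ; zero; suc; pred; _+_; _*_; _∸_; _^_; _≤_; _<_; _/_; _%_; _≡ᵇ_; z≤n; s≤s; z<s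
        ; NonZero; ≢-nonZero; >-nonZero; _<?_)
open import Data.Nat.DivMod
open import Data.Nat.Divisibility using (_∣_; divides; 1∣_; m∣m*n; *-cancelˡ-∣; m%n≡0⇒n∣m; n∣m⇒m%n≡0)
open import Data.Nat.Induction using (<-rec)
import Data.Nat.Solver as ℕ-Solver
open import Data.Nat.Properties
open import Data.Product using (∃; ∃₂; _×_; _,_; proj₁; proj₂)
import Data.Product
open import Data.Sum using (_⊎_; inj₁; inj₂)
import Data.Sum
open import Function using (_∘_; flip)
open import Relation.Binary.PropositionalEquality hiding ([_]; J)
open import Relation.Binary.Definitions using (tri<; tri≈; tri>)
open import Relation.Nullary using (¬_; yes; no)

open ≡-Reasoning

true≢false : true ≢ false
true≢false ()

xor≡true⇒ : ∀ a b → a xor b ≡ true → b ≡ not a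
xor≡true⇒ true  false _ = refl
xor≡true⇒ false true  _ = refl

xor≡false⇒ : ∀ a b → a xor b ≡ false → b ≡ a
xor≡false⇒ true  true  _ = refl
xor≡false⇒ false false _ = refl

isOddℕ-2+ : ∀ n → isOddℕ (2 + n) ≡ isOddℕ n
isOddℕ-2+ n = cong (_≡ᵇ 1) (trans (cong (_% 2) (+-comm 2 n)) ([m+n]%n≡m%n n 2))

isOddℕ-suc : ∀ n → isOddℕ (suc n) ≡ not (isOddℕ n)
isOddℕ-suc zero    = refl
isOddℕ-suc (suc n) =
  trans (isOddℕ-2+ n) (trans (sym (not-involutive _)) (cong not (sym (isOddℕ-suc n))))

isOddℕ-+ : ∀ m n → isOddℕ (m + n) ≡ isOddℕ m xor isOddℕ n
isOddℕ-+ zero    n = refl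
isOddℕ-+ (suc m) n = begin
  isOddℕ (suc (m + n))         ≡⟨ isOddℕ-suc (m + n) ⟩
  not (isOddℕ (m + n))         ≡⟨ cong not (isOddℕ-+ m n) ⟩
  not (isOddℕ m xor isOddℕ n)  ≡⟨ not-distribˡ-xor (isOddℕ m) (isOddℕ n) ⟩
  not (isOddℕ m) xor isOddℕ n  ≡⟨ cong (_xor isOddℕ n) (isOddℕ-suc m) ⟨
  isOddℕ (suc m) xor isOddℕ n  ∎

isOdd-+1 : ∀ x → isOdd (x +ℤ 1ℤ) ≡ not (isOdd x)
isOdd-+1 (+ n)          = trans (cong isOddℕ (+-comm n 1)) (isOddℕ-suc n)
isOdd-+1 -[1+ zero ]    = refl
isOdd-+1 -[1+ suc n ]   = trans (sym (not-involutive _)) (cong not (sym (isOddℕ-suc (suc n))))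

isOdd-+-pos : ∀ x n → isOdd (x +ℤ + n) ≡ isOdd x xor isOddℕ n
isOdd-+-pos x zero    = trans (cong isOdd (ℤ.+-identityʳ x)) (sym (xor-identityʳ _))
isOdd-+-pos x (suc n) = begin
  isOdd (x +ℤ + suc n)            ≡⟨ cong (λ k → isOdd (x +ℤ + k)) (+-comm 1 n) ⟩
  isOdd (x +ℤ (+ n +ℤ 1ℤ))        ≡⟨ cong isOdd (ℤ.+-assoc x (+ n) 1ℤ) ⟨
  isOdd ((x +ℤ + n) +ℤ 1ℤ)        ≡⟨ isOdd-+1 (x +ℤ + n) ⟩
  not (isOdd (x +ℤ + n))          ≡⟨ cong not (isOdd-+-pos x n) ⟩
  not (isOdd x xor isOddℕ n)      ≡⟨ not-distribʳ-xor (isOdd x) (isOddℕ n) ⟩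
  isOdd x xor not (isOddℕ n)      ≡⟨ cong (isOdd x xor_) (isOddℕ-suc n) ⟨
  isOdd x xor isOddℕ (suc n)      ∎

isOdd-+ : ∀ x y → isOdd (x +ℤ y) ≡ isOdd x xor isOdd y
isOdd-+ x (+ n)    = isOdd-+-pos x n
isOdd-+ x -[1+ n ] = begin
  isOdd s                    ≡⟨ xor-identityʳ _ ⟨
  isOdd s xor false          ≡⟨ cong (isOdd s xor_) (xor-same c) ⟨
  isOdd s xor (c xor c)      ≡⟨ xor-assoc (isOdd s) c c ⟨
  (isOdd s xor c) xor c      ≡⟨ cong (_xor c) (isOdd-+-pos s (suc n)) ⟨
  isOdd (s +ℤ + suc n) xor c ≡⟨ cong (λ z → isOdd z xor c) s+[1+n]≡x ⟩
  isOdd x xor c              ∎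
  where
  s : ℤ
  s = x +ℤ -[1+ n ]
  c : Bool
  c = isOddℕ (suc n)
  s+[1+n]≡x : s +ℤ + suc n ≡ x
  s+[1+n]≡x = trans (ℤ.+-assoc x -[1+ n ] (+ suc n))
                (trans (cong (x +ℤ_) (ℤ.+-inverseˡ (+ suc n))) (ℤ.+-identityʳ x))

isOdd-+2 : ∀ x → isOdd (x +ℤ + 2) ≡ isOdd x
isOdd-+2 x = trans (isOdd-+-pos x 2) (xor-identityʳ (isOdd x))

parities : List ℤ → List Bool
parities = map isOdd

parities-bump : ∀ j xs → parities (bump j xs) ≡ parities xs
parities-bump j       []       = refl
parities-bump zero    (x ∷ xs) = cong (_∷ parities xs) (isOdd-+2 x)
parities-bump (suc j) (x ∷ xs) = cong (isOdd x ∷_) (parities-bump j xs)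

firstOdd-resp-parities : ∀ xs ys → parities xs ≡ parities ys → firstOdd xs ≡ firstOdd ys
firstOdd-resp-parities []       []       _  = refl
firstOdd-resp-parities (x ∷ xs) (y ∷ ys) eq with ∷-injective eq
... | x≡y , xs≡ys = cong₂ (λ b n → if b then zero else suc n) x≡y (firstOdd-resp-parities xs ys xs≡ys)

isOdd-entry-resp-parities : ∀ {xs ys} → parities xs ≡ parities ys → ∀ i → isOdd (entry xs i) ≡ isOdd (entry ys i)
isOdd-entry-resp-parities {[]}     {[]}     _  i       = refl
isOdd-entry-resp-parities {x ∷ xs} {y ∷ ys} eq zero    = proj₁ (∷-injective eq)
isOdd-entry-resp-parities {x ∷ xs} {y ∷ ys} eq (suc i) = isOdd-entry-resp-parities (proj₂ (∷-injective eq)) i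

length-resp-parities : ∀ xs ys → parities xs ≡ parities ys → length xs ≡ length ys
length-resp-parities xs ys eq = trans (sym (length-map isOdd xs)) (trans (cong length eq) (length-map isOdd ys))

length-addAt : ∀ j d xs → length (addAt j d xs) ≡ length xs
length-addAt j       d []       = refl
length-addAt zero    d (x ∷ xs) = refl
length-addAt (suc j) d (x ∷ xs) = cong suc (length-addAt j d xs)

addAt-comm : ∀ j k d e xs → addAt j d (addAt k e xs) ≡ addAt k e (addAt j d xs)
addAt-comm j       k       d e []       = refl
addAt-comm zero    zero    d e (x ∷ xs) =
  cong (_∷ xs) (trans (ℤ.+-assoc x e d) (trans (cong (x +ℤ_) (ℤ.+-comm e d)) (sym (ℤ.+-assoc x d e))))
addAt-comm zero    (suc k) d e (x ∷ xs) = refl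
addAt-comm (suc j) zero    d e (x ∷ xs) = refl
addAt-comm (suc j) (suc k) d e (x ∷ xs) = cong (x ∷_) (addAt-comm j k d e xs)

addAt-addAt : ∀ j d e xs → addAt j d (addAt j e xs) ≡ addAt j (e +ℤ d) xs
addAt-addAt j       d e []       = refl
addAt-addAt zero    d e (x ∷ xs) = cong (_∷ xs) (ℤ.+-assoc x e d)
addAt-addAt (suc j) d e (x ∷ xs) = cong (x ∷_) (addAt-addAt j d e xs)

head-addAt-suc : ∀ j d xs → entry (addAt (suc j) d xs) 0 ≡ entry xs 0
head-addAt-suc j d []       = refl
head-addAt-suc j d (x ∷ xs) = refl

allEven-++ : ∀ xs ys → allEven (xs ++ ys) ≡ allEven xs ∧ allEven ys
allEven-++ []       ys = refl
allEven-++ (x ∷ xs) ys with isOdd x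
... | true  = refl
... | false = allEven-++ xs ys

allEven-∷ʳ : ∀ xs x → allEven (xs ∷ʳ x) ≡ allEven xs ∧ not (isOdd x)
allEven-∷ʳ xs x = trans (allEven-++ xs [ x ]) (cong (allEven xs ∧_) (∧-identityʳ _))

allEven-reverse : ∀ xs → allEven (reverse xs) ≡ allEven xs
allEven-reverse []       = refl
allEven-reverse (x ∷ xs) = begin
  allEven (reverse (x ∷ xs))              ≡⟨ cong allEven (unfold-reverse x xs) ⟩
  allEven (reverse xs ∷ʳ x)               ≡⟨ allEven-∷ʳ (reverse xs) x ⟩
  allEven (reverse xs) ∧ not (isOdd x)    ≡⟨ cong (_∧ not (isOdd x)) (allEven-reverse xs) ⟩
  allEven xs ∧ not (isOdd x)              ≡⟨ ∧-comm (allEven xs) _ ⟩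
  not (isOdd x) ∧ allEven xs              ∎

firstOdd<length : ∀ xs → allEven xs ≡ false → firstOdd xs < length xs
firstOdd<length (x ∷ xs) ae with isOdd x
... | true  = s≤s z≤n
... | false = s≤s (firstOdd<length xs ae)

firstOdd-++ˡ : ∀ xs ys → firstOdd xs < length xs → firstOdd (xs ++ ys) ≡ firstOdd xs
firstOdd-++ˡ (x ∷ xs) ys lt with isOdd x
... | true  = refl
... | false = cong suc (firstOdd-++ˡ xs ys (≤-pred lt))

length≤firstOdd-++ : ∀ xs ys → allEven xs ≡ true → length xs ≤ firstOdd (xs ++ ys)
length≤firstOdd-++ []       ys ae = z≤n
length≤firstOdd-++ (x ∷ xs) ys ae with isOdd x
... | false = s≤s (length≤firstOdd-++ xs ys ae)

isOdd-entry-firstOdd : ∀ xs → firstOdd xs < length xs → isOdd (entry xs (firstOdd xs)) ≡ true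
isOdd-entry-firstOdd (x ∷ xs) lt with isOdd x in ox
... | true  = ox
... | false = isOdd-entry-firstOdd xs (≤-pred lt)

isOdd-entry-<firstOdd : ∀ xs k → k < firstOdd xs → isOdd (entry xs k) ≡ false
isOdd-entry-<firstOdd (x ∷ xs) k lt with isOdd x in ox
isOdd-entry-<firstOdd (x ∷ xs) zero    lt | false = ox
isOdd-entry-<firstOdd (x ∷ xs) (suc k) lt | false = isOdd-entry-<firstOdd xs k (≤-pred lt)

firstOdd-addAt-above : ∀ xs k d → firstOdd xs < length xs → firstOdd xs < k →
                       firstOdd (addAt k d xs) ≡ firstOdd xs
firstOdd-addAt-above (x ∷ xs) (suc k) d lt below with isOdd x
... | true  = refl
... | false = cong suc (firstOdd-addAt-above xs k d (≤-pred lt) (≤-pred below))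

length-∷ʳ : ∀ (xs : List ℤ) x → length (xs ∷ʳ x) ≡ suc (length xs)
length-∷ʳ xs x = trans (length-++ xs) (+-comm (length xs) 1)

data HalveOrIncrement : Rule → Set where
  is-halve     : HalveOrIncrement halve
  is-increment : HalveOrIncrement increment

halveIfMinusOne : State → Rule
halveIfMinusOne S = if entry S 0 ==ℤ -1ℤ then halve else increment

halveIfMinusOne-halve : ∀ S → entry S 0 ≡ -1ℤ → halveIfMinusOne S ≡ halve
halveIfMinusOne-halve S e with entry S 0 ≟ℤ -1ℤ
... | yes _ = refl
... | no ne = ⊥-elim (ne e)

halveIfMinusOne-increment : ∀ S → entry S 0 ≢ -1ℤ → halveIfMinusOne S ≡ increment
halveIfMinusOne-increment S ne with entry S 0 ≟ℤ -1ℤ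
... | yes e = ⊥-elim (ne e)
... | no _  = refl

halveIfMinusOne≡halve : ∀ S → halveIfMinusOne S ≡ halve → entry S 0 ≡ -1ℤ
halveIfMinusOne≡halve S h with entry S 0 ≟ℤ -1ℤ
... | yes e = e

halveIfMinusOne≡increment : ∀ S → halveIfMinusOne S ≡ increment → entry S 0 ≢ -1ℤ
halveIfMinusOne≡increment S h with entry S 0 ≟ℤ -1ℤ
... | no ne = ne

-- ruleRev S (top ∷ s ∷ rest) unfolds to this function of its four tests.
ruleOf : (overflows evenState minusOne topZeros : Bool) → Rule
ruleOf ov ae m1 tz =
  if ov then overflow else if ae then (if tz then halt else zeroR) else (if m1 then halve else increment)

ruleOf-moving : ∀ ov ae m1 tz → HalveOrIncrement (ruleOf ov ae m1 tz) → ov ≡ false × ae ≡ false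
ruleOf-moving false false m1    tz    _ = refl , refl
ruleOf-moving true  ae    m1    tz    ()
ruleOf-moving false true  m1    true  ()
ruleOf-moving false true  m1    false ()

ruleOf-zeroR : ∀ ov ae m1 tz → ruleOf ov ae m1 tz ≡ zeroR → ae ≡ true × tz ≡ false
ruleOf-zeroR false true  m1    false _ = refl , refl
ruleOf-zeroR true  ae    m1    tz    ()
ruleOf-zeroR false true  m1    true  ()
ruleOf-zeroR false false true  tz    ()
ruleOf-zeroR false false false tz    ()

ruleOf-halt : ∀ ov ae m1 tz → ruleOf ov ae m1 tz ≡ halt → tz ≡ true
ruleOf-halt false true  m1    true  _ = refl
ruleOf-halt true  ae    m1    tz    ()
ruleOf-halt false true  m1    false ()
ruleOf-halt false false true  tz    ()
ruleOf-halt false false false tz    ()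

data TopView : State → Set where
  none   : TopView []
  single : ∀ x → TopView (x ∷ [])
  top2   : ∀ xs s x → TopView (xs ∷ʳ s ∷ʳ x)

topView : ∀ S → TopView S
topView S with initLast S
... | []       = none
... | xs ∷ʳ′ x with initLast xs
...   | []       = single x
...   | ys ∷ʳ′ s = top2 ys s x

rule-top2 : ∀ xs s x → let S = xs ∷ʳ s ∷ʳ x in
  rule S ≡ ruleOf (isOdd x ∧ allEven (xs ∷ʳ s)) (allEven S) (entry S 0 ==ℤ -1ℤ) ((x ==ℤ 0ℤ) ∧ (s ==ℤ 0ℤ))
rule-top2 xs s x = begin
  ruleRev S (reverse (xs ∷ʳ s ∷ʳ x))  ≡⟨ cong (ruleRev S) reverse-S ⟩
  ruleRev S (x ∷ s ∷ reverse xs)      ≡⟨ cong (λ b → ruleOf (isOdd x ∧ b) (allEven S) m1 tz) allEven-init ⟩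
  ruleOf (isOdd x ∧ allEven (xs ∷ʳ s)) (allEven S) (entry S 0 ==ℤ -1ℤ) ((x ==ℤ 0ℤ) ∧ (s ==ℤ 0ℤ)) ∎
  where
  S : State
  S = xs ∷ʳ s ∷ʳ x
  m1 tz : Bool
  m1 = entry S 0 ==ℤ -1ℤ
  tz = (x ==ℤ 0ℤ) ∧ (s ==ℤ 0ℤ)
  reverse-S : reverse S ≡ x ∷ s ∷ reverse xs
  reverse-S = trans (reverse-++ (xs ∷ʳ s) [ x ]) (cong (x ∷_) (reverse-++ xs [ s ]))
  allEven-init : allEven (s ∷ reverse xs) ≡ allEven (xs ∷ʳ s)
  allEven-init = trans (cong allEven (sym (reverse-++ xs [ s ]))) (allEven-reverse (xs ∷ʳ s))

-- `suc (firstOdd S) < length S` says that an entry below the top one is odd.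
below-top⇒rule : ∀ S → suc (firstOdd S) < length S → rule S ≡ halveIfMinusOne S
below-top⇒rule S lt with topView S
below-top⇒rule .(x ∷ []) (s≤s ()) | single x
below-top⇒rule .(xs ∷ʳ s ∷ʳ x) lt | top2 xs s x =
  trans (rule-top2 xs s x) (cong₂ (λ ov ae → ruleOf ov ae m1 tz) overflows evenState)
  where
  ys : List ℤ
  ys = xs ∷ʳ s
  m1 tz : Bool
  m1 = entry (ys ∷ʳ x) 0 ==ℤ -1ℤ
  tz = (x ==ℤ 0ℤ) ∧ (s ==ℤ 0ℤ)
  lt′ : firstOdd (ys ∷ʳ x) < length ys
  lt′ = ≤-pred (subst (suc (firstOdd (ys ∷ʳ x)) <_) (length-∷ʳ ys x) lt)
  mixedInit : allEven ys ≡ false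
  mixedInit with allEven ys in ae
  ... | false = refl
  ... | true  = ⊥-elim (<⇒≱ lt′ (length≤firstOdd-++ ys [ x ] ae))
  overflows : isOdd x ∧ allEven ys ≡ false
  overflows = trans (cong (isOdd x ∧_) mixedInit) (∧-zeroʳ (isOdd x))
  evenState : allEven (ys ∷ʳ x) ≡ false
  evenState = trans (allEven-∷ʳ ys x) (cong (_∧ not (isOdd x)) mixedInit)

moving⇒below-top : ∀ S → HalveOrIncrement (rule S) → suc (firstOdd S) < length S
moving⇒below-top S h with topView S
moving⇒below-top .[] () | none
moving⇒below-top .(x ∷ []) h | single x with isOdd x
moving⇒below-top .(x ∷ []) () | single x | true
moving⇒below-top .(x ∷ []) () | single x | false
moving⇒below-top .(xs ∷ʳ s ∷ʳ x) h | top2 xs s x =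
  subst (suc (firstOdd (ys ∷ʳ x)) <_) (sym (length-∷ʳ ys x))
    (s≤s (subst (_< length ys) (sym (firstOdd-++ˡ ys [ x ] (firstOdd<length ys mixedInit)))
                 (firstOdd<length ys mixedInit)))
  where
  ys : List ℤ
  ys = xs ∷ʳ s
  tests : isOdd x ∧ allEven ys ≡ false × allEven (ys ∷ʳ x) ≡ false
  tests = ruleOf-moving (isOdd x ∧ allEven ys) (allEven (ys ∷ʳ x)) (entry (ys ∷ʳ x) 0 ==ℤ -1ℤ)
                        ((x ==ℤ 0ℤ) ∧ (s ==ℤ 0ℤ)) (subst HalveOrIncrement (rule-top2 xs s x) h)
  mixed : ∀ a b → a ∧ b ≡ false → b ∧ not a ≡ false → b ≡ false
  mixed a     false _  _ = refl
  mixed false true  _  ()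
  mixed true  true  () _
  mixedInit : allEven ys ≡ false
  mixedInit = mixed (isOdd x) (allEven ys) (proj₁ tests) (trans (sym (allEven-∷ʳ ys x)) (proj₂ tests))

zeroR⇒allEven : ∀ S → rule S ≡ zeroR → allEven S ≡ true × 2 ≤ length S
zeroR⇒allEven S r with topView S
zeroR⇒allEven .[] () | none
zeroR⇒allEven .(x ∷ []) r | single x with isOdd x
zeroR⇒allEven .(x ∷ []) () | single x | true
zeroR⇒allEven .(x ∷ []) () | single x | false
zeroR⇒allEven .(xs ∷ʳ s ∷ʳ x) r | top2 xs s x =
  proj₁ (ruleOf-zeroR (isOdd x ∧ allEven (xs ∷ʳ s)) (allEven (xs ∷ʳ s ∷ʳ x)) (entry (xs ∷ʳ s ∷ʳ x) 0 ==ℤ -1ℤ)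
                      ((x ==ℤ 0ℤ) ∧ (s ==ℤ 0ℤ)) (trans (sym (rule-top2 xs s x)) r)) ,
  subst (2 ≤_) (sym (trans (length-∷ʳ (xs ∷ʳ s) x) (cong suc (length-∷ʳ xs s)))) (s≤s (s≤s z≤n))

allEven⇒halt⊎zeroR : ∀ S → allEven S ≡ true → rule S ≡ halt ⊎ rule S ≡ zeroR
allEven⇒halt⊎zeroR S ae with topView S
... | none = inj₁ refl
allEven⇒halt⊎zeroR .(x ∷ []) ae | single x with isOdd x
... | false = inj₁ refl
allEven⇒halt⊎zeroR .(xs ∷ʳ s ∷ʳ x) ae | top2 xs s x =
  Data.Sum.map (trans rule≡) (trans rule≡) (haltOrZero ((x ==ℤ 0ℤ) ∧ (s ==ℤ 0ℤ)))
  where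
  ys : List ℤ
  ys = xs ∷ʳ s
  topEven : isOdd x ≡ false
  topEven with isOdd x in ox
  ... | false = refl
  ... | true  = trans (sym ae) (trans (allEven-∷ʳ ys x)
                  (trans (cong (λ b → allEven ys ∧ not b) ox) (∧-zeroʳ (allEven ys))))
  rule≡ : rule (ys ∷ʳ x) ≡ (if (x ==ℤ 0ℤ) ∧ (s ==ℤ 0ℤ) then halt else zeroR)
  rule≡ = trans (rule-top2 xs s x)
    (cong₂ (λ ov e → ruleOf ov e (entry (ys ∷ʳ x) 0 ==ℤ -1ℤ) ((x ==ℤ 0ℤ) ∧ (s ==ℤ 0ℤ))) (cong (_∧ allEven ys) topEven) ae)
  haltOrZero : ∀ b → (if b then halt else zeroR) ≡ halt ⊎ (if b then halt else zeroR) ≡ zeroR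
  haltOrZero true  = inj₁ refl
  haltOrZero false = inj₂ refl

rule≡increment⇒ : ∀ S → rule S ≡ increment → suc (firstOdd S) < length S × entry S 0 ≢ -1ℤ
rule≡increment⇒ S r = below , halveIfMinusOne≡increment S (trans (sym (below-top⇒rule S below)) r)
  where
  below : suc (firstOdd S) < length S
  below = moving⇒below-top S (subst HalveOrIncrement (sym r) is-increment)

rule≡halve⇒ : ∀ S → rule S ≡ halve → suc (firstOdd S) < length S × entry S 0 ≡ -1ℤ
rule≡halve⇒ S r = below , halveIfMinusOne≡halve S (trans (sym (below-top⇒rule S below)) r)
  where
  below : suc (firstOdd S) < length S
  below = moving⇒below-top S (subst HalveOrIncrement (sym r) is-halve)

moving-resp-parities : ∀ S T → HalveOrIncrement (rule S) → parities S ≡ parities T →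
                       rule T ≡ halveIfMinusOne T
moving-resp-parities S T h eq = below-top⇒rule T
  (subst₂ (λ f l → suc f < l) (firstOdd-resp-parities S T eq) (length-resp-parities S T eq)
          (moving⇒below-top S h))

P-increment : ∀ S → rule S ≡ increment → P S ≡ just (incrementS S)
P-increment S r rewrite r = refl

P-halve : ∀ S → rule S ≡ halve → P S ≡ just (halveS S)
P-halve S r rewrite r = refl

P-zeroR : ∀ S → rule S ≡ zeroR → P S ≡ just (zeroS S)
P-zeroR S r rewrite r = refl

iter-suc : ∀ n S → iter (suc n) S ≡ (iter n S >>= P)
iter-suc n S with iter n S
... | nothing = refl
... | just G  = refl

same-state : ∀ m S {G H} → iter m S ≡ just G → iter m S ≡ just H → G ≡ H
same-state m S itG itH = just-injective (trans (sym itG) itH)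

iter-suc-just : ∀ n S G → iter n S ≡ just G → iter (suc n) S ≡ P G
iter-suc-just n S G it = trans (iter-suc n S) (cong (_>>= P) it)

iter-+ : ∀ m S G → iter m S ≡ just G → ∀ n → iter (n + m) S ≡ iter n G
iter-+ m S G it zero    = it
iter-+ m S G it (suc n) =
  trans (iter-suc (n + m) S) (trans (cong (_>>= P) (iter-+ m S G it n)) (sym (iter-suc n G)))

iter-1+ : ∀ S G → P S ≡ just G → ∀ n → iter (suc n) S ≡ iter n G
iter-1+ S G step n = trans (cong (λ k → iter k S) (+-comm 1 n)) (iter-+ 1 S G step n)

sumℤ-addAt : ∀ k d xs → k < length xs → sumℤ (addAt k d xs) ≡ sumℤ xs +ℤ d
sumℤ-addAt zero    d (x ∷ xs) _  =
  trans (ℤ.+-assoc x d _) (trans (cong (x +ℤ_) (ℤ.+-comm d _)) (sym (ℤ.+-assoc x _ d)))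
sumℤ-addAt (suc k) d (x ∷ xs) lt = trans (cong (x +ℤ_) (sumℤ-addAt k d xs (≤-pred lt))) (sym (ℤ.+-assoc x _ d))

isOdd-sumℤ-bump : ∀ k xs → isOdd (sumℤ (bump k xs)) ≡ isOdd (sumℤ xs)
isOdd-sumℤ-bump k       []       = refl
isOdd-sumℤ-bump zero    (x ∷ xs) = begin
  isOdd ((x +ℤ + 2) +ℤ sumℤ xs)           ≡⟨ isOdd-+ (x +ℤ + 2) (sumℤ xs) ⟩
  isOdd (x +ℤ + 2) xor isOdd (sumℤ xs)    ≡⟨ cong (_xor isOdd (sumℤ xs)) (isOdd-+2 x) ⟩
  isOdd x xor isOdd (sumℤ xs)             ≡⟨ isOdd-+ x (sumℤ xs) ⟨
  isOdd (x +ℤ sumℤ xs)                    ∎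
isOdd-sumℤ-bump (suc k) (x ∷ xs) = begin
  isOdd (x +ℤ sumℤ (bump k xs))           ≡⟨ isOdd-+ x (sumℤ (bump k xs)) ⟩
  isOdd x xor isOdd (sumℤ (bump k xs))    ≡⟨ cong (isOdd x xor_) (isOdd-sumℤ-bump k xs) ⟩
  isOdd x xor isOdd (sumℤ xs)             ≡⟨ isOdd-+ x (sumℤ xs) ⟨
  isOdd (x +ℤ sumℤ xs)                    ∎

isOdd-sumℤ-incrementS : ∀ S → suc (firstOdd S) < length S → isOdd (sumℤ (incrementS S)) ≡ isOdd (sumℤ S)
isOdd-sumℤ-incrementS S lt = cong isOdd (begin
  sumℤ (addAt 0 -1ℤ S⁺)
    ≡⟨ sumℤ-addAt 0 -1ℤ S⁺ (subst (0 <_) (sym (length-addAt _ 1ℤ S)) (<-trans z<s lt)) ⟩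
  sumℤ S⁺ +ℤ -1ℤ
    ≡⟨ cong (_+ℤ -1ℤ) (sumℤ-addAt (suc (firstOdd S)) 1ℤ S lt) ⟩
  (sumℤ S +ℤ 1ℤ) +ℤ -1ℤ
    ≡⟨ trans (ℤ.+-assoc (sumℤ S) 1ℤ -1ℤ) (ℤ.+-identityʳ (sumℤ S)) ⟩
  sumℤ S ∎)
  where
  S⁺ : State
  S⁺ = addAt (suc (firstOdd S)) 1ℤ S

isOdd-sumℤ-halveS : ∀ S → entry S 0 ≡ -1ℤ → isOdd (sumℤ (halveS S)) ≡ not (isOdd (sumℤ S))
isOdd-sumℤ-halveS (x ∷ xs) refl = trans (sym (not-involutive _)) (cong not (sym (isOdd-+ -1ℤ (sumℤ xs))))

data Ends : State → Set where
  ends : ∀ x ys t → Ends (x ∷ (ys ∷ʳ t))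

ends? : ∀ S → 2 ≤ length S → Ends S
ends? (x ∷ rest) len with initLast rest
ends? (x ∷ .[]) (s≤s ()) | []
... | ys ∷ʳ′ t = ends x ys t

zeroS-ends : ∀ x ys t → zeroS (x ∷ (ys ∷ʳ t)) ≡ (x -ℤ 1ℤ) ∷ (ys ++ (t +ℤ 1ℤ) ∷ 0ℤ ∷ 0ℤ ∷ [])
zeroS-ends x ys t = begin
  onHead (_-ℤ 1ℤ) (reverse (0ℤ ∷ 0ℤ ∷ onHead (_+ℤ 1ℤ) (reverse ((x ∷ ys) ∷ʳ t))))
    ≡⟨ cong (λ l → onHead (_-ℤ 1ℤ) (reverse (0ℤ ∷ 0ℤ ∷ onHead (_+ℤ 1ℤ) l))) (reverse-++ (x ∷ ys) [ t ]) ⟩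
  onHead (_-ℤ 1ℤ) (reverse ((0ℤ ∷ 0ℤ ∷ (t +ℤ 1ℤ) ∷ []) ++ reverse (x ∷ ys)))
    ≡⟨ cong (onHead (_-ℤ 1ℤ)) (reverse-++ (0ℤ ∷ 0ℤ ∷ (t +ℤ 1ℤ) ∷ []) (reverse (x ∷ ys))) ⟩
  onHead (_-ℤ 1ℤ) (reverse (reverse (x ∷ ys)) ++ (t +ℤ 1ℤ) ∷ 0ℤ ∷ 0ℤ ∷ [])
    ≡⟨ cong (λ l → onHead (_-ℤ 1ℤ) (l ++ (t +ℤ 1ℤ) ∷ 0ℤ ∷ 0ℤ ∷ [])) (reverse-involutive (x ∷ ys)) ⟩
  (x -ℤ 1ℤ) ∷ (ys ++ (t +ℤ 1ℤ) ∷ 0ℤ ∷ 0ℤ ∷ []) ∎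

isOdd-sumℤ-zeroS : ∀ S → 2 ≤ length S → isOdd (sumℤ (zeroS S)) ≡ isOdd (sumℤ S)
isOdd-sumℤ-zeroS S len with ends? S len
... | ends x ys t = cong isOdd (begin
  sumℤ (zeroS (x ∷ (ys ∷ʳ t)))
    ≡⟨ cong sumℤ (zeroS-ends x ys t) ⟩
  (x -ℤ 1ℤ) +ℤ sumℤ (ys ++ (t +ℤ 1ℤ) ∷ 0ℤ ∷ 0ℤ ∷ [])
    ≡⟨ cong ((x -ℤ 1ℤ) +ℤ_) (sumℤ-++ ys _) ⟩
  (x -ℤ 1ℤ) +ℤ (sumℤ ys +ℤ ((t +ℤ 1ℤ) +ℤ (0ℤ +ℤ (0ℤ +ℤ 0ℤ))))
    ≡⟨ solve 3 (λ x s t → (x :- con 1ℤ) :+ (s :+ ((t :+ con 1ℤ) :+ (con 0ℤ :+ (con 0ℤ :+ con 0ℤ))))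
                         := x :+ (s :+ (t :+ con 0ℤ))) refl x (sumℤ ys) t ⟩
  x +ℤ (sumℤ ys +ℤ (t +ℤ 0ℤ))
    ≡⟨ cong (x +ℤ_) (sumℤ-++ ys [ t ]) ⟨
  sumℤ (x ∷ (ys ∷ʳ t)) ∎)
  where
  open ℤ-Solver.+-*-Solver using (solve; _:+_; _:-_; con; _:=_)
  sumℤ-++ : ∀ xs ys → sumℤ (xs ++ ys) ≡ sumℤ xs +ℤ sumℤ ys
  sumℤ-++ []       ys = sym (ℤ.+-identityˡ _)
  sumℤ-++ (x ∷ xs) ys = trans (cong (x +ℤ_) (sumℤ-++ xs ys)) (sym (ℤ.+-assoc x _ _))

addAt-++ˡ : ∀ i d xs ys → i < length xs → addAt i d (xs ++ ys) ≡ addAt i d xs ++ ys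
addAt-++ˡ zero    d (x ∷ xs) ys _  = refl
addAt-++ˡ (suc i) d (x ∷ xs) ys lt = cong (x ∷_) (addAt-++ˡ i d xs ys (≤-pred lt))

addAt-length-++ : ∀ d xs z zs → addAt (length xs) d (xs ++ z ∷ zs) ≡ xs ++ (z +ℤ d) ∷ zs
addAt-length-++ d []       z zs = refl
addAt-length-++ d (x ∷ xs) z zs = cong (x ∷_) (addAt-length-++ d xs z zs)

zeroS-bump-bottom : ∀ x ys t → zeroS (bump 0 (x ∷ (ys ∷ʳ t))) ≡ bump 0 (zeroS (x ∷ (ys ∷ʳ t)))
zeroS-bump-bottom x ys t = begin
  zeroS ((x +ℤ + 2) ∷ (ys ∷ʳ t))                ≡⟨ zeroS-ends (x +ℤ + 2) ys t ⟩
  ((x +ℤ + 2) -ℤ 1ℤ) ∷ (ys ++ top)              ≡⟨ cong (_∷ (ys ++ top)) (xy∙z≈xz∙y x (+ 2) -1ℤ) ⟩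
  bump 0 ((x -ℤ 1ℤ) ∷ (ys ++ top))              ≡⟨ cong (bump 0) (zeroS-ends x ys t) ⟨
  bump 0 (zeroS (x ∷ (ys ∷ʳ t)))                ∎
  where
  top : List ℤ
  top = (t +ℤ 1ℤ) ∷ 0ℤ ∷ 0ℤ ∷ []

zeroS-bump-middle : ∀ x ys t i → i < length ys →
                    zeroS (bump (suc i) (x ∷ (ys ∷ʳ t))) ≡ bump (suc i) (zeroS (x ∷ (ys ∷ʳ t)))
zeroS-bump-middle x ys t i i<ys = begin
  zeroS (x ∷ addAt i (+ 2) (ys ∷ʳ t))           ≡⟨ cong (zeroS ∘ (x ∷_)) (addAt-++ˡ i (+ 2) ys _ i<ys) ⟩
  zeroS (x ∷ (addAt i (+ 2) ys ∷ʳ t))           ≡⟨ zeroS-ends x _ t ⟩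
  (x -ℤ 1ℤ) ∷ (addAt i (+ 2) ys ++ top)         ≡⟨ cong ((x -ℤ 1ℤ) ∷_) (addAt-++ˡ i (+ 2) ys top i<ys) ⟨
  bump (suc i) ((x -ℤ 1ℤ) ∷ (ys ++ top))        ≡⟨ cong (bump (suc i)) (zeroS-ends x ys t) ⟨
  bump (suc i) (zeroS (x ∷ (ys ∷ʳ t)))          ∎
  where
  top : List ℤ
  top = (t +ℤ 1ℤ) ∷ 0ℤ ∷ 0ℤ ∷ []

zeroS-bump-top : ∀ x ys t → let i = suc (length ys) in
                 zeroS (bump i (x ∷ (ys ∷ʳ t))) ≡ bump i (zeroS (x ∷ (ys ∷ʳ t)))
zeroS-bump-top x ys t = begin
  zeroS (x ∷ addAt (length ys) (+ 2) (ys ∷ʳ t))       ≡⟨ cong (zeroS ∘ (x ∷_)) (addAt-length-++ (+ 2) ys t []) ⟩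
  zeroS (x ∷ (ys ∷ʳ (t +ℤ + 2)))                      ≡⟨ zeroS-ends x ys _ ⟩
  (x -ℤ 1ℤ) ∷ (ys ++ ((t +ℤ + 2) +ℤ 1ℤ) ∷ zs)
    ≡⟨ cong (λ z → (x -ℤ 1ℤ) ∷ (ys ++ z ∷ zs)) (xy∙z≈xz∙y t (+ 2) 1ℤ) ⟩
  (x -ℤ 1ℤ) ∷ (ys ++ ((t +ℤ 1ℤ) +ℤ + 2) ∷ zs)
    ≡⟨ cong ((x -ℤ 1ℤ) ∷_) (addAt-length-++ (+ 2) ys _ zs) ⟨
  bump (suc (length ys)) ((x -ℤ 1ℤ) ∷ (ys ++ (t +ℤ 1ℤ) ∷ zs))
    ≡⟨ cong (bump (suc (length ys))) (zeroS-ends x ys t) ⟨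
  bump (suc (length ys)) (zeroS (x ∷ (ys ∷ʳ t))) ∎
  where
  zs : List ℤ
  zs = 0ℤ ∷ 0ℤ ∷ []

zeroS-bump : ∀ S i → 2 ≤ length S → i < length S → zeroS (bump i S) ≡ bump i (zeroS S)
zeroS-bump S i len lt with ends? S len
zeroS-bump .(x ∷ (ys ∷ʳ t)) zero    len lt | ends x ys t = zeroS-bump-bottom x ys t
zeroS-bump .(x ∷ (ys ∷ʳ t)) (suc i) len lt | ends x ys t with i <? length ys
... | yes i<ys = zeroS-bump-middle x ys t i i<ys
... | no  i≮ys rewrite ≤-antisym (≤-pred (subst (suc i ≤_) (length-∷ʳ ys t) (≤-pred lt))) (≮⇒≥ i≮ys) =
  zeroS-bump-top x ys t

incrementS-bump : ∀ S j → incrementS (bump j S) ≡ bump j (incrementS S)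
incrementS-bump S j = begin
  addAt 0 -1ℤ (addAt (suc (firstOdd (bump j S))) 1ℤ (bump j S))
    ≡⟨ cong (λ k → addAt 0 -1ℤ (addAt (suc k) 1ℤ (bump j S))) (firstOdd-resp-parities _ _ (parities-bump j S)) ⟩
  addAt 0 -1ℤ (addAt (suc (firstOdd S)) 1ℤ (bump j S))
    ≡⟨ cong (addAt 0 -1ℤ) (addAt-comm (suc (firstOdd S)) j 1ℤ (+ 2) S) ⟩
  addAt 0 -1ℤ (bump j (addAt (suc (firstOdd S)) 1ℤ S))
    ≡⟨ addAt-comm 0 j -1ℤ (+ 2) _ ⟩
  bump j (incrementS S) ∎

halveS-bump : ∀ S j → halveS (bump (suc j) S) ≡ bump j (halveS S)
halveS-bump []       j = refl
halveS-bump (x ∷ xs) j = refl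

-- Rounded binary digits

_div2^_ : ℕ → ℕ → ℕ
m div2^ k = _/_ m (2 ^ k) {{m^n≢0 2 k}}

[r+q*d]/d≡q : ∀ r q d .{{_ : NonZero d}} → r < d → (r + q * d) / d ≡ q
[r+q*d]/d≡q r q d r<d =
  trans (+-distrib-/-∣ʳ r (divides q refl)) (cong₂ _+_ (m<n⇒m/n≡0 r<d) (m*n/n≡m q d))

half+half : ∀ y → y / 2 + suc y / 2 ≡ y
half+half zero          = refl
half+half (suc zero)    = refl
half+half (suc (suc y)) = begin
  suc (suc y) / 2 + suc (suc (suc y)) / 2
    ≡⟨ cong₂ _+_ (2+n/2 y) (2+n/2 (suc y)) ⟩
  suc (y / 2) + suc (suc y / 2)  ≡⟨ +-suc (suc (y / 2)) (suc y / 2) ⟩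
  suc (suc (y / 2 + suc y / 2))  ≡⟨ cong (suc ∘ suc) (half+half y) ⟩
  suc (suc y)                    ∎
  where
  2+n/2 : ∀ n → (2 + n) / 2 ≡ suc (n / 2)
  2+n/2 n = m/n≡1+[m∸n]/n {2 + n} {2} (s≤s (s≤s z≤n))

div2^-suc : ∀ m s → m div2^ suc s ≡ (m div2^ s) / 2
div2^-suc m s = trans (/-congʳ {{m^n≢0 2 (suc s)}} {{nz}} (*-comm 2 (2 ^ s)))
                      (sym (m/n/o≡m/[n*o] m (2 ^ s) 2 {{m^n≢0 2 s}} {{_}} {{nz}}))
  where
  nz : NonZero (2 ^ s * 2)
  nz = m*n≢0 (2 ^ s) 2 {{m^n≢0 2 s}}

-- Hermite's identity ⟨x⟩ + ⌊x⌋ = ⌊2x⌋ at x = h / 2^(s+1).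
hermite : ∀ h s → roundPow h (suc s) + h div2^ suc s ≡ h div2^ s
hermite h s = begin
  roundPow h (suc s) + h div2^ suc s  ≡⟨ cong₂ _+_ round≡ (div2^-suc h s) ⟩
  suc y / 2 + y / 2                   ≡⟨ +-comm (suc y / 2) (y / 2) ⟩
  y / 2 + suc y / 2                   ≡⟨ half+half y ⟩
  y                                   ∎
  where
  open ℕ-Solver.+-*-Solver using (solve; _:+_; _:*_; con; _:=_)
  d : ℕ
  d = 2 ^ s
  instance
    d≢0 : NonZero d
    d≢0 = m^n≢0 2 s
    2d≢0 : NonZero (2 * d)
    2d≢0 = m^n≢0 2 (suc s)
  y r : ℕ
  y = h / d
  r = h % d
  numerator : 2 * h + 2 ^ suc s ≡ 2 * r + suc y * (2 * d)
  numerator = trans (cong (λ t → 2 * t + 2 * d) (m≡m%n+[m/n]*n h d))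
    (solve 3 (λ r y d → con 2 :* (r :+ y :* d) :+ con 2 :* d := con 2 :* r :+ (con 1 :+ y) :* (con 2 :* d)) refl r y d)
  round≡ : roundPow h (suc s) ≡ suc y / 2
  round≡ = trans (div2^-suc (2 * h + 2 ^ suc s) (suc s))
                 (cong (_/ 2) (trans (/-congˡ numerator) ([r+q*d]/d≡q (2 * r) (suc y) (2 * d) (*-monoʳ-< 2 (m%n<n h d)))))

sumRoundPow : ℕ → ℕ → ℕ → ℕ
sumRoundPow h s zero    = 0
sumRoundPow h s (suc n) = roundPow h s + sumRoundPow h (suc s) n

sumRoundPow+div2^ : ∀ h n s → sumRoundPow h (suc s) n + h div2^ (s + n) ≡ h div2^ s
sumRoundPow+div2^ h zero    s = cong (h div2^_) (+-identityʳ s)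
sumRoundPow+div2^ h (suc n) s = begin
  (roundPow h (suc s) + rest) + h div2^ (s + suc n)  ≡⟨ +-assoc (roundPow h (suc s)) rest _ ⟩
  roundPow h (suc s) + (rest + h div2^ (s + suc n))
    ≡⟨ cong (λ k → roundPow h (suc s) + (rest + h div2^ k)) (+-suc s n) ⟩
  roundPow h (suc s) + (rest + h div2^ (suc s + n))
    ≡⟨ cong (_+_ (roundPow h (suc s))) (sumRoundPow+div2^ h n (suc s)) ⟩
  roundPow h (suc s) + h div2^ suc s                 ≡⟨ hermite h s ⟩
  h div2^ s                                          ∎
  where
  rest : ℕ
  rest = sumRoundPow h (suc (suc s)) n

sumRoundPow≡ : ∀ h n → h < 2 ^ n → sumRoundPow h 1 n ≡ h
sumRoundPow≡ h n h<2ⁿ = begin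
  sumRoundPow h 1 n                      ≡⟨ +-identityʳ _ ⟨
  sumRoundPow h 1 n + 0                  ≡⟨ cong (_+_ (sumRoundPow h 1 n)) (m<n⇒m/n≡0 {{m^n≢0 2 n}} h<2ⁿ) ⟨
  sumRoundPow h 1 n + h div2^ (0 + n)    ≡⟨ sumRoundPow+div2^ h n 0 ⟩
  h / 1                                  ≡⟨ n/1≡n h ⟩
  h                                      ∎

roundPow-0 : ∀ i → roundPow 0 i ≡ 0
roundPow-0 i = m<n⇒m/n≡0 {{m^n≢0 2 (suc i)}} (^-monoʳ-< 2 (s≤s (s≤s z≤n)) (n<1+n i))

isOddℕ≡false⇒2∣ : ∀ n → isOddℕ n ≡ false → 2 ∣ n
isOddℕ≡false⇒2∣ n even = m%n≡0⇒n∣m n 2 (digit (n % 2) (m%n<n n 2) even)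
  where
  digit : ∀ r → r < 2 → (r ≡ᵇ 1) ≡ false → r ≡ 0
  digit zero          _                _  = refl
  digit (suc zero)    _                ()
  digit (suc (suc _)) (s≤s (s≤s ()))   _

2∣⇒isOddℕ≡false : ∀ n → 2 ∣ n → isOddℕ n ≡ false
2∣⇒isOddℕ≡false n 2∣n = cong (_≡ᵇ 1) (n∣m⇒m%n≡0 n 2 2∣n)

isOddℕ-2^suc*o : ∀ k o → isOddℕ (2 ^ suc k * o) ≡ false
isOddℕ-2^suc*o k o = 2∣⇒isOddℕ≡false _ (divides (2 ^ k * o) (trans (*-assoc 2 (2 ^ k) o) (*-comm 2 (2 ^ k * o))))

OddDecomposition : ℕ → Set
OddDecomposition m = ∃₂ λ v o → m ≡ 2 ^ v * o × isOddℕ o ≡ true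

oddDecomposition : ∀ m → m ≢ 0 → OddDecomposition m
oddDecomposition = <-rec (λ m → m ≢ 0 → OddDecomposition m) step
  where
  step : ∀ m → (∀ {k} → k < m → k ≢ 0 → OddDecomposition k) → m ≢ 0 → OddDecomposition m
  step m rec m≢0 with isOddℕ m in odd
  ... | true  = 0 , m , sym (+-identityʳ m) , odd
  ... | false with isOddℕ≡false⇒2∣ m odd
  ...   | divides q refl with rec q<q*2 q≢0
    where
    q≢0 : q ≢ 0
    q≢0 refl = m≢0 refl
    q<q*2 : q < q * 2
    q<q*2 = m<m*n q 2 {{≢-nonZero q≢0}} (s≤s (s≤s z≤n))
  ...     | v , o , refl , oddo = suc v , o , trans (*-comm (2 ^ v * o) 2) (sym (*-assoc 2 (2 ^ v) o)) , oddo

Val2-2^v*o : ∀ v o → isOddℕ o ≡ true → Val2 (2 ^ v * o) v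
Val2-2^v*o v o odd = m∣m*n o , not-2^suc
  where
  not-2^suc : ¬ (2 ^ suc v ∣ 2 ^ v * o)
  not-2^suc d with trans (sym (2∣⇒isOddℕ≡false o
                     (*-cancelˡ-∣ (2 ^ v) {{m^n≢0 2 v}} (subst (_∣ 2 ^ v * o) (*-comm 2 (2 ^ v)) d)))) odd
  ... | ()

roundPow-multiple : ∀ i M h → 1 ≤ i → (h ≡ 2 ^ i * M) ⊎ (suc h ≡ 2 ^ i * M) → roundPow h i ≡ M
roundPow-multiple i M h 1≤i (inj₁ h≡) = trans (/-congˡ numerator) ([r+q*d]/d≡q (2 ^ i) M (2 ^ suc i) 2^i<2^suc-i)
  where
  open ℕ-Solver.+-*-Solver using (solve; _:+_; _:*_; con; _:=_)
  instance
    2^suc-i≢0 : NonZero (2 ^ suc i)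
    2^suc-i≢0 = m^n≢0 2 (suc i)
  2^i<2^suc-i : 2 ^ i < 2 ^ suc i
  2^i<2^suc-i = ^-monoʳ-< 2 (s≤s (s≤s z≤n)) (n<1+n i)
  numerator : 2 * h + 2 ^ i ≡ 2 ^ i + M * (2 * 2 ^ i)
  numerator = trans (cong (λ t → 2 * t + 2 ^ i) h≡)
                (solve 2 (λ X M → con 2 :* (X :* M) :+ X := X :+ M :* (con 2 :* X)) refl (2 ^ i) M)
roundPow-multiple i M h 1≤i (inj₂ 1+h≡) =
  trans (/-congˡ numerator)
        ([r+q*d]/d≡q (X ∸ 2) M (2 ^ suc i) (≤-<-trans (m∸n≤m X 2) (^-monoʳ-< 2 (s≤s (s≤s z≤n)) (n<1+n i))))
  where
  open ℕ-Solver.+-*-Solver using (solve; _:+_; _:*_; con; _:=_)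
  instance
    2^suc-i≢0 : NonZero (2 ^ suc i)
    2^suc-i≢0 = m^n≢0 2 (suc i)
  X : ℕ
  X = 2 ^ i
  2≤2^ : ∀ j → 1 ≤ j → 2 ≤ 2 ^ j
  2≤2^ (suc j) _ = *-monoʳ-≤ 2 (m^n>0 2 j)
  numerator : 2 * h + X ≡ (X ∸ 2) + M * (2 * X)
  numerator = begin
    2 * h + X                 ≡⟨ cong (_+_ (2 * h)) (m∸n+n≡m (2≤2^ i 1≤i)) ⟨
    2 * h + ((X ∸ 2) + 2)
      ≡⟨ solve 2 (λ h e → con 2 :* h :+ (e :+ con 2) := e :+ con 2 :* (con 1 :+ h)) refl h (X ∸ 2) ⟩
    (X ∸ 2) + 2 * suc h       ≡⟨ cong (λ t → (X ∸ 2) + 2 * t) 1+h≡ ⟩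
    (X ∸ 2) + 2 * (X * M)
      ≡⟨ cong (_+_ (X ∸ 2)) (solve 2 (λ X M → con 2 :* (X :* M) := M :* (con 2 :* X)) refl X M) ⟩
    (X ∸ 2) + M * (2 * X)     ∎

roundPow-2^v*o : ∀ v o h i → 1 ≤ i → i ≤ v → (h ≡ 2 ^ v * o) ⊎ (suc h ≡ 2 ^ v * o) →
                 roundPow h i ≡ 2 ^ (v ∸ i) * o
roundPow-2^v*o v o h i 1≤i i≤v h≈ with m≤n⇒∃[o]m+o≡n i≤v
... | d , refl = trans (roundPow-multiple i (2 ^ d * o) h 1≤i (Data.Sum.map (flip trans 2^v*o≡) (flip trans 2^v*o≡) h≈))
                       (cong (λ k → 2 ^ k * o) (sym (m+n∸m≡n i d)))
  where
  2^v*o≡ : 2 ^ (i + d) * o ≡ 2 ^ i * (2 ^ d * o)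
  2^v*o≡ = trans (cong (_* o) (^-distribˡ-+-* 2 i d)) (*-assoc (2 ^ i) (2 ^ d) o)

-- Where a desynchronised run rejoins

resyncIndex : State → ℕ
resyncIndex Y = firstOdd (addAt 0 1ℤ Y)

DigitsFrom : ℕ → ℕ → List ℤ → Set
DigitsFrom h s ys = ∀ k → k < length ys → isOdd (entry ys k) ≡ isOddℕ (roundPow h (s + k))

IsN⇒digits : ∀ y ys h → IsN (y ∷ ys) h → DigitsFrom h 1 ys
IsN⇒digits y ys h (_ , digits) k k<len = sym (digits (suc k) (s≤s z≤n) k<len)

isOdd-sumℤ-digits : ∀ h s ys → DigitsFrom h s ys → isOdd (sumℤ ys) ≡ isOddℕ (sumRoundPow h s (length ys))
isOdd-sumℤ-digits h s []       _      = refl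
isOdd-sumℤ-digits h s (z ∷ zs) digits = begin
  isOdd (z +ℤ sumℤ zs)                                    ≡⟨ isOdd-+ z (sumℤ zs) ⟩
  isOdd z xor isOdd (sumℤ zs)
    ≡⟨ cong₂ _xor_ head (isOdd-sumℤ-digits h (suc s) zs tail) ⟩
  isOddℕ (roundPow h s) xor isOddℕ (sumRoundPow h (suc s) (length zs)) ≡⟨ isOddℕ-+ (roundPow h s) _ ⟨
  isOddℕ (sumRoundPow h s (suc (length zs)))              ∎
  where
  head : isOdd z ≡ isOddℕ (roundPow h s)
  head = trans (digits 0 (s≤s z≤n)) (cong (isOddℕ ∘ roundPow h) (+-identityʳ s))
  tail : DigitsFrom h (suc s) zs
  tail k k<len = trans (digits (suc k) (s≤s k<len)) (cong (isOddℕ ∘ roundPow h) (+-suc s k))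

isOdd-sumℤ-IsN : ∀ y ys h → IsN (y ∷ ys) h → isOdd (sumℤ (y ∷ ys)) ≡ isOdd y xor isOddℕ h
isOdd-sumℤ-IsN y ys h isN@(h< , _) = begin
  isOdd (y +ℤ sumℤ ys)                                 ≡⟨ isOdd-+ y (sumℤ ys) ⟩
  isOdd y xor isOdd (sumℤ ys)
    ≡⟨ cong (isOdd y xor_) (isOdd-sumℤ-digits h 1 ys (IsN⇒digits y ys h isN)) ⟩
  isOdd y xor isOddℕ (sumRoundPow h 1 (length ys))
    ≡⟨ cong (λ n → isOdd y xor isOddℕ n) (sumRoundPow≡ h (length ys) h<) ⟩
  isOdd y xor isOddℕ h                                 ∎

firstOdd-digits : ∀ ys h w o → DigitsFrom h 1 ys →
                  (∀ i → 1 ≤ i → i ≤ suc w → roundPow h i ≡ 2 ^ (suc w ∸ i) * o) → isOddℕ o ≡ true →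
                  firstOdd ys < length ys → firstOdd ys ≡ w
firstOdd-digits ys h w o digits round oddo lt with <-cmp (firstOdd ys) w
... | tri≈ _ f≡w _ = f≡w
... | tri< f<w _ _ = ⊥-elim (true≢false (begin
  true                                            ≡⟨ isOdd-entry-firstOdd ys lt ⟨
  isOdd (entry ys (firstOdd ys))                  ≡⟨ digits (firstOdd ys) lt ⟩
  isOddℕ (roundPow h (suc (firstOdd ys)))
    ≡⟨ cong isOddℕ (round (suc (firstOdd ys)) (s≤s z≤n) (s≤s (<⇒≤ f<w))) ⟩
  isOddℕ (2 ^ (w ∸ firstOdd ys) * o)              ≡⟨ cong (λ k → isOddℕ (2 ^ k * o)) w∸f≡suc ⟩
  isOddℕ (2 ^ suc (pred (w ∸ firstOdd ys)) * o)   ≡⟨ isOddℕ-2^suc*o (pred (w ∸ firstOdd ys)) o ⟩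
  false                                           ∎))
  where
  w∸f≡suc : w ∸ firstOdd ys ≡ suc (pred (w ∸ firstOdd ys))
  w∸f≡suc = sym (suc-pred (w ∸ firstOdd ys) {{>-nonZero (m<n⇒0<n∸m f<w)}})
... | tri> _ _ w<f = ⊥-elim (true≢false (begin
  true                                            ≡⟨ oddo ⟨
  isOddℕ o                                        ≡⟨ cong isOddℕ (+-identityʳ o) ⟨
  isOddℕ (2 ^ 0 * o)                              ≡⟨ cong (λ k → isOddℕ (2 ^ k * o)) (n∸n≡0 w) ⟨
  isOddℕ (2 ^ (suc w ∸ suc w) * o)                ≡⟨ cong isOddℕ (round (suc w) (s≤s z≤n) ≤-refl) ⟨
  isOddℕ (roundPow h (suc w))                     ≡⟨ digits w (<-trans w<f lt) ⟨
  isOdd (entry ys w)                              ≡⟨ isOdd-entry-<firstOdd ys w w<f ⟩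
  false                                           ∎))

Val2-suc-firstOdd : ∀ ys h m → DigitsFrom h 1 ys → (m ≡ h) ⊎ (m ≡ suc h) → m ≢ 0 → isOddℕ m ≡ false →
                    firstOdd ys < length ys → Val2 m (suc (firstOdd ys))
Val2-suc-firstOdd ys h m digits m≈h m≢0 even lt with oddDecomposition m m≢0
... | zero  , o , m≡o , oddo =
  ⊥-elim (true≢false (trans (sym oddo) (trans (cong isOddℕ (sym (trans m≡o (+-identityʳ o)))) even)))
... | suc w , o , m≡ , oddo = subst₂ Val2 (sym m≡) (cong suc (sym firstOdd≡w)) (Val2-2^v*o (suc w) o oddo)
  where
  h≈ : (h ≡ 2 ^ suc w * o) ⊎ (suc h ≡ 2 ^ suc w * o)
  h≈ = Data.Sum.map (λ m≡h → trans (sym m≡h) m≡) (λ m≡1+h → trans (sym m≡1+h) m≡) m≈h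
  firstOdd≡w : firstOdd ys ≡ w
  firstOdd≡w = firstOdd-digits ys h w o digits (λ i 1≤i i≤ → roundPow-2^v*o (suc w) o h i 1≤i i≤ h≈) oddo lt

Val2-resyncIndex : ∀ y ys h m → IsN (y ∷ ys) h → (m ≡ h) ⊎ (m ≡ suc h) → isOddℕ m ≡ isOdd (y +ℤ 1ℤ) →
                   resyncIndex (y ∷ ys) < length (y ∷ ys) → Val2 m (resyncIndex (y ∷ ys))
Val2-resyncIndex y ys h m isN m≈h parity lt with isOdd (y +ℤ 1ℤ)
... | true  = 1∣ m , λ 2∣m → true≢false (trans (sym parity) (2∣⇒isOddℕ≡false m 2∣m))
... | false = Val2-suc-firstOdd ys h m digits m≈h m≢0 parity (≤-pred lt)
  where
  digits : DigitsFrom h 1 ys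
  digits = IsN⇒digits y ys h isN
  h≢0 : h ≢ 0
  h≢0 h≡0 = true≢false (begin
    true                                     ≡⟨ isOdd-entry-firstOdd ys (≤-pred lt) ⟨
    isOdd (entry ys (firstOdd ys))           ≡⟨ digits (firstOdd ys) (≤-pred lt) ⟩
    isOddℕ (roundPow h (suc (firstOdd ys)))  ≡⟨ cong (λ k → isOddℕ (roundPow k (suc (firstOdd ys)))) h≡0 ⟩
    isOddℕ (roundPow 0 (suc (firstOdd ys)))  ≡⟨ cong isOddℕ (roundPow-0 (suc (firstOdd ys))) ⟩
    false                                    ∎)
  m≢0 : m ≢ 0
  m≢0 m≡0 = Data.Sum.[ (λ m≡h → h≢0 (trans (sym m≡h) m≡0)) , (λ m≡1+h → 0≢1+n (trans (sym m≡0) m≡1+h)) ]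
              m≈h

resyncIndex-odd : ∀ Y h → IsN Y h → isOdd (sumℤ Y) ≡ true → resyncIndex Y < length Y → Val2 h (resyncIndex Y)
resyncIndex-odd (y ∷ ys) h isN odd = Val2-resyncIndex y ys h h isN (inj₁ refl) (begin
  isOddℕ h            ≡⟨ xor≡true⇒ (isOdd y) (isOddℕ h) (trans (sym (isOdd-sumℤ-IsN y ys h isN)) odd) ⟩
  not (isOdd y)       ≡⟨ isOdd-+1 y ⟨
  isOdd (y +ℤ 1ℤ)     ∎)

resyncIndex-even : ∀ Y h → IsN Y h → isOdd (sumℤ Y) ≡ false → resyncIndex Y < length Y →
                   Val2 (suc h) (resyncIndex Y)
resyncIndex-even (y ∷ ys) h isN even = Val2-resyncIndex y ys h (suc h) isN (inj₂ refl) (begin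
  isOddℕ (suc h)      ≡⟨ isOddℕ-suc h ⟩
  not (isOddℕ h)
    ≡⟨ cong not (xor≡false⇒ (isOdd y) (isOddℕ h) (trans (sym (isOdd-sumℤ-IsN y ys h isN)) even)) ⟩
  not (isOdd y)       ≡⟨ isOdd-+1 y ⟨
  isOdd (y +ℤ 1ℤ)     ∎)

-- Empty states

entries⇒allEven : ∀ xs → (∀ k → k < length xs → isOdd (entry xs k) ≡ false) → allEven xs ≡ true
entries⇒allEven []       _    = refl
entries⇒allEven (x ∷ xs) even =
  cong₂ (λ b r → not b ∧ r) (even 0 (s≤s z≤n)) (entries⇒allEven xs (λ k k< → even (suc k) (s≤s k<)))

allEven⇒isOdd-sumℤ : ∀ xs → allEven xs ≡ true → isOdd (sumℤ xs) ≡ false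
allEven⇒isOdd-sumℤ []       _  = refl
allEven⇒isOdd-sumℤ (x ∷ xs) ae with isOdd x in ox
... | false = trans (isOdd-+ x (sumℤ xs)) (cong₂ _xor_ ox (allEven⇒isOdd-sumℤ xs ae))

σ≡-1⇒even : ∀ S → σ S ≡ -1ℤ → isOdd (sumℤ S) ≡ false
σ≡-1⇒even S σ≡ with isOdd (sumℤ S)
... | false = refl

Empty⇒allEven : ∀ G → Empty G → allEven G ≡ true
Empty⇒allEven []       _                        = refl
Empty⇒allEven (x ∷ xs) ((_ , digits) , σ≡ , _) =
  trans (cong (λ b → not b ∧ allEven xs) headEven) tailEven
  where
  tailEven : allEven xs ≡ true
  tailEven = entries⇒allEven xs
    (λ k k< → trans (sym (digits (suc k) (s≤s z≤n) k<)) (cong isOddℕ (roundPow-0 (suc k))))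
  headEven : isOdd x ≡ false
  headEven = begin
    isOdd x                      ≡⟨ xor-identityʳ (isOdd x) ⟨
    isOdd x xor false            ≡⟨ cong (isOdd x xor_) (allEven⇒isOdd-sumℤ xs tailEven) ⟨
    isOdd x xor isOdd (sumℤ xs)  ≡⟨ isOdd-+ x (sumℤ xs) ⟨
    isOdd (sumℤ (x ∷ xs))        ≡⟨ σ≡-1⇒even (x ∷ xs) σ≡ ⟩
    false                        ∎

Empty⇒zeroR : ∀ G → Empty G → rule G ≡ zeroR
Empty⇒zeroR G empty@(_ , _ , ¬halt) with allEven⇒halt⊎zeroR G (Empty⇒allEven G empty)
... | inj₁ halts = ⊥-elim (¬halt halts)
... | inj₂ zeroes = zeroes

moving⇒¬Empty : ∀ G → HalveOrIncrement (rule G) → ¬ Empty G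
moving⇒¬Empty G moving empty with rule G | Empty⇒zeroR G empty
moving⇒¬Empty G () empty | .zeroR | refl

NonNegative : State → Set
NonNegative = All (0ℤ ≤ℤ_)

All-reverse : ∀ {P : ℤ → Set} {xs} → All P xs → All P (reverse xs)
All-reverse ps = All.tabulate (λ x∈ → All.lookup ps (Any.reverse⁻ x∈))

-- Halt needs the two top entries to be 0, which raising nonnegative entries cannot bring about.
raise-¬halt : ∀ {S S′ R R′} → Pointwise _≤ℤ_ R R′ → NonNegative R →
              ruleRev S R ≡ zeroR → ruleRev S′ R′ ≢ halt
raise-¬halt {R = t ∷ []} _ _ isZero with isOdd t
raise-¬halt {R = t ∷ []} _ _ () | true
raise-¬halt {R = t ∷ []} _ _ () | false
raise-¬halt {S} {S′} {t ∷ s ∷ rest} {t′ ∷ s′ ∷ rest′} (t≤ ∷ s≤ ∷ _) (0≤t ∷ 0≤s ∷ _) isZero halts =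
  true≢false (trans (sym topZeros) notTopZeros)
  where
  notTopZeros : (t ==ℤ 0ℤ) ∧ (s ==ℤ 0ℤ) ≡ false
  notTopZeros = proj₂ (ruleOf-zeroR (isOdd t ∧ allEven (s ∷ rest)) (allEven S) (entry S 0 ==ℤ -1ℤ) _ isZero)
  raised : (t′ ==ℤ 0ℤ) ∧ (s′ ==ℤ 0ℤ) ≡ true
  raised = ruleOf-halt (isOdd t′ ∧ allEven (s′ ∷ rest′)) (allEven S′) (entry S′ 0 ==ℤ -1ℤ) _ halts
  ==0 : ∀ {x x′} → x ≤ℤ x′ → 0ℤ ≤ℤ x → (x′ ==ℤ 0ℤ) ≡ true → x ≡ 0ℤ
  ==0 {x′ = x′} x≤ 0≤x eq with x′ ≟ℤ 0ℤ
  ... | yes refl = ℤ.≤-antisym x≤ 0≤x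
  ∧≡true : ∀ {a b} → a ∧ b ≡ true → a ≡ true × b ≡ true
  ∧≡true {true} {true} _ = refl , refl
  topZeros : (t ==ℤ 0ℤ) ∧ (s ==ℤ 0ℤ) ≡ true
  topZeros rewrite ==0 t≤ 0≤t (proj₁ (∧≡true raised)) | ==0 s≤ 0≤s (proj₂ (∧≡true raised)) = refl

bump-raises : ∀ c xs → Pointwise _≤ℤ_ xs (bump c xs)
bump-raises c       []       = []
bump-raises zero    (x ∷ xs) = ℤ.i≤i+j x (+ 2) ∷ Pointwise.refl ℤ.≤-refl
bump-raises (suc c) (x ∷ xs) = ℤ.≤-refl ∷ bump-raises c xs

Empty-bump : ∀ F c → Empty F → NonNegative F → Empty (bump c F)
Empty-bump F c empty@((lt , digits) , σ≡ , _) nonneg = (lt′ , digits′) , σ≡′ , ¬halt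
  where
  lt′ : 0 < 2 ^ ell (bump c F)
  lt′ = subst (λ l → 0 < 2 ^ (l ∸ 1)) (sym (length-addAt c (+ 2) F)) lt
  digits′ : ∀ i → 1 ≤ i → i ≤ ell (bump c F) → isOddℕ (roundPow 0 i) ≡ isOdd (entry (bump c F) i)
  digits′ i 1≤i i≤ = trans (digits i 1≤i (subst (λ l → i ≤ l ∸ 1) (length-addAt c (+ 2) F) i≤))
                           (isOdd-entry-resp-parities (sym (parities-bump c F)) i)
  σ≡′ : σ (bump c F) ≡ -1ℤ
  σ≡′ = trans (cong (λ b → if b then 1ℤ else -1ℤ) (isOdd-sumℤ-bump c F)) σ≡
  ¬halt : rule (bump c F) ≢ halt
  ¬halt = raise-¬halt (Pointwise.reverse⁺ (bump-raises c F)) (All-reverse nonneg) (Empty⇒zeroR F empty)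

-- Reachable states

AtLeast-1 : State → Set
AtLeast-1 = All (-1ℤ ≤ℤ_)

even⇒nonneg : ∀ x → -1ℤ ≤ℤ x → isOdd x ≡ false → 0ℤ ≤ℤ x
even⇒nonneg (+ n)        _         _  = +≤+ z≤n
even⇒nonneg -[1+ suc n ] (-≤- ()) _

≢-1⇒nonneg : ∀ x → -1ℤ ≤ℤ x → x ≢ -1ℤ → 0ℤ ≤ℤ x
≢-1⇒nonneg (+ n)        _         _    = +≤+ z≤n
≢-1⇒nonneg -[1+ zero ]  _         ≢-1  = ⊥-elim (≢-1 refl)
≢-1⇒nonneg -[1+ suc n ] (-≤- ()) _

-1≤[x-1] : ∀ x → 0ℤ ≤ℤ x → -1ℤ ≤ℤ x -ℤ 1ℤ
-1≤[x-1] x 0≤x = ℤ.+-monoˡ-≤ -1ℤ 0≤x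

-1≤[x+1] : ∀ x → -1ℤ ≤ℤ x → -1ℤ ≤ℤ x +ℤ 1ℤ
-1≤[x+1] x -1≤x = ℤ.≤-trans -1≤x (ℤ.i≤i+j x 1ℤ)

All-addAt : ∀ {P : ℤ → Set} k d → (∀ x → P x → P (x +ℤ d)) → ∀ {xs} → All P xs → All P (addAt k d xs)
All-addAt k       d f []         = []
All-addAt zero    d f (px ∷ pxs) = f _ px ∷ pxs
All-addAt (suc k) d f (px ∷ pxs) = px ∷ All-addAt k d f pxs

All-onHead : ∀ {P : ℤ → Set} g → (∀ x → P x → P (g x)) → ∀ {xs} → All P xs → All P (onHead g xs)
All-onHead g f []         = []
All-onHead g f (px ∷ pxs) = f _ px ∷ pxs

zeroS-AtLeast-1 : ∀ S → rule S ≡ zeroR → AtLeast-1 S → AtLeast-1 (zeroS S)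
zeroS-AtLeast-1 S r ok with zeroR⇒allEven S r
... | even , len with ends? S len
...   | ends x ys t with ok
...     | -1≤x ∷ rest = subst AtLeast-1 (sym (zeroS-ends x ys t))
  (-1≤[x-1] x (even⇒nonneg x -1≤x headEven) ∷
   ++⁺ (++⁻ˡ ys rest) (-1≤[x+1] t (All.head (++⁻ʳ ys rest)) ∷ -≤+ ∷ -≤+ ∷ []))
  where
  headEven : isOdd x ≡ false
  headEven with isOdd x in ox
  ... | false = refl
  ... | true  = sym even

incrementS-AtLeast-1 : ∀ S → rule S ≡ increment → AtLeast-1 S → AtLeast-1 (incrementS S)
incrementS-AtLeast-1 (x ∷ xs) r (-1≤x ∷ rest) =
  -1≤[x-1] x (≢-1⇒nonneg x -1≤x (proj₂ (rule≡increment⇒ (x ∷ xs) r))) ∷ All-addAt _ 1ℤ -1≤[x+1] rest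

P-AtLeast-1 : ∀ S S′ → AtLeast-1 S → P S ≡ just S′ → AtLeast-1 S′
P-AtLeast-1 S S′ ok next with rule S in r
... | overflow  = subst AtLeast-1 (just-injective next)
                    (All-reverse (-≤+ ∷ All-onHead (_+ℤ 1ℤ) -1≤[x+1] (All-reverse ok)))
... | zeroR     = subst AtLeast-1 (just-injective next) (zeroS-AtLeast-1 S r ok)
... | halve     = subst AtLeast-1 (just-injective next) (drop⁺ 1 ok)
... | increment = subst AtLeast-1 (just-injective next) (incrementS-AtLeast-1 S r ok)

iter-AtLeast-1 : ∀ n S T → AtLeast-1 S → iter n S ≡ just T → AtLeast-1 T
iter-AtLeast-1 zero    S T ok it = subst AtLeast-1 (just-injective it) ok
iter-AtLeast-1 (suc n) S T ok it with iter n S in itn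
... | just G = P-AtLeast-1 G T (iter-AtLeast-1 n S G ok itn) it

Sk-AtLeast-1 : ∀ k → AtLeast-1 (Sk k)
Sk-AtLeast-1 k = -≤+ ∷ appendZero-AtLeast-1 (powsDown-AtLeast-1 (2 * k))
  where
  powsDown-AtLeast-1 : ∀ m → AtLeast-1 (powsDown m)
  powsDown-AtLeast-1 zero    = []
  powsDown-AtLeast-1 (suc m) = -≤+ ∷ powsDown-AtLeast-1 m
  appendZero-AtLeast-1 : ∀ {xs} → AtLeast-1 xs → AtLeast-1 (appendZero xs)
  appendZero-AtLeast-1 []         = -≤+ ∷ []
  appendZero-AtLeast-1 (px ∷ pxs) = px ∷ appendZero-AtLeast-1 pxs

reachable-AtLeast-1 : ∀ k F → Sk k ↦ F → AtLeast-1 F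
reachable-AtLeast-1 k F (n , it) = iter-AtLeast-1 n (Sk k) F (Sk-AtLeast-1 k) it

allEven-AtLeast-1⇒NonNegative : ∀ F → allEven F ≡ true → AtLeast-1 F → NonNegative F
allEven-AtLeast-1⇒NonNegative []       _  []           = []
allEven-AtLeast-1⇒NonNegative (x ∷ xs) ae (-1≤x ∷ rest) with isOdd x in ox
... | false = even⇒nonneg x -1≤x ox ∷ allEven-AtLeast-1⇒NonNegative xs ae rest

reachable-Empty⇒NonNegative : ∀ k F → Sk k ↦ F → Empty F → NonNegative F
reachable-Empty⇒NonNegative k F reach empty =
  allEven-AtLeast-1⇒NonNegative F (Empty⇒allEven F empty) (reachable-AtLeast-1 k F reach)

NextEmpty⇒Empty : ∀ {E F} → NextEmpty E F → Empty F
NextEmpty⇒Empty (_ , _ , _ , empty , _) = empty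

data Increments : State → ℕ → State → Set where
  done : ∀ {S} → Increments S 0 S
  step : ∀ {S n T} → rule S ≡ increment → Increments (incrementS S) n T → Increments S (suc n) T

data Run : State → List Rule → State → Set where
  []  : ∀ {S} → Run S [] S
  _∷_ : ∀ {S S′ r rs T} → rule S ≡ r × P S ≡ just S′ → Run S′ rs T → Run S (r ∷ rs) T

incs : ℕ → List Rule
incs n = replicate n increment

-- `halt` past the end of the list; only consulted at positions inside it.
ruleAt : List Rule → ℕ → Rule
ruleAt []       m       = halt
ruleAt (r ∷ rs) zero    = r
ruleAt (r ∷ rs) (suc m) = ruleAt rs m

Increments-++ : ∀ {S U T m n} → Increments S m U → Increments U n T → Increments S (m + n) T
Increments-++ done       r₂ = r₂
Increments-++ (step r r₁) r₂ = step r (Increments-++ r₁ r₂)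

Run-++ : ∀ {S U T rs ss} → Run S rs U → Run U ss T → Run S (rs ++ ss) T
Run-++ []       r₂ = r₂
Run-++ (s ∷ r₁) r₂ = s ∷ Run-++ r₁ r₂

Increments⇒Run : ∀ {S n T} → Increments S n T → Run S (incs n) T
Increments⇒Run done                = []
Increments⇒Run {S} (step r run) = (r , P-increment S r) ∷ Increments⇒Run run

Run⇒iter : ∀ {S rs T} → Run S rs T → iter (length rs) S ≡ just T
Run⇒iter []                              = refl
Run⇒iter {S} {_ ∷ rs} ((_ , next) ∷ run) = trans (iter-1+ S _ next (length rs)) (Run⇒iter run)

Run-at : ∀ {S rs T} → Run S rs T → ∀ m → m < length rs → ∃ λ G → iter m S ≡ just G × rule G ≡ ruleAt rs m
Run-at {S} ((r , _) ∷ run)    zero    _  = S , refl , r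
Run-at {S} ((_ , next) ∷ run) (suc m) lt with Run-at run m (≤-pred lt)
... | G , it , r = G , trans (iter-1+ S _ next m) it , r

isOdd-sumℤ-Increments : ∀ {S n T} → Increments S n T → isOdd (sumℤ S) ≡ isOdd (sumℤ T)
isOdd-sumℤ-Increments done              = refl
isOdd-sumℤ-Increments {S} (step r run) =
  trans (sym (isOdd-sumℤ-incrementS S (proj₁ (rule≡increment⇒ S r)))) (isOdd-sumℤ-Increments run)

Increments-AtLeast-1 : ∀ {S n T} → AtLeast-1 S → Increments S n T → AtLeast-1 T
Increments-AtLeast-1 ok done             = ok
Increments-AtLeast-1 {S} ok (step r run) = Increments-AtLeast-1 (incrementS-AtLeast-1 S r ok) run

embankedRules : ℕ → ℕ → ℕ → List Rule
embankedRules a b c = zeroR ∷ (incs a ++ halve ∷ (incs b ++ halve ∷ incs c))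

length-incs-++ : ∀ n ys → length (incs n ++ ys) ≡ n + length ys
length-incs-++ n ys = trans (length-++ (incs n)) (cong (_+ length ys) (length-replicate n))

length-embankedRules : ∀ a b c → length (embankedRules a b c) ≡ suc (a + suc (b + suc c))
length-embankedRules a b c = cong suc (trans (length-incs-++ a _)
  (cong (λ k → a + suc k) (trans (length-incs-++ b _) (cong (λ k → b + suc k) (length-replicate c)))))

ruleAt-incs : ∀ n m → m < n → ruleAt (incs n) m ≡ increment
ruleAt-incs (suc n) zero    _  = refl
ruleAt-incs (suc n) (suc m) lt = ruleAt-incs n m (≤-pred lt)

ruleAt-incs-++ : ∀ n ys m → ruleAt (incs n ++ ys) m ≡ increment ⊎
                 ∃ λ k → m ≡ n + k × ruleAt (incs n ++ ys) m ≡ ruleAt ys k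
ruleAt-incs-++ zero    ys m       = inj₂ (m , refl , refl)
ruleAt-incs-++ (suc n) ys zero    = inj₁ refl
ruleAt-incs-++ (suc n) ys (suc m) with ruleAt-incs-++ n ys m
... | inj₁ inc           = inj₁ inc
... | inj₂ (k , m≡ , at) = inj₂ (k , cong suc m≡ , at)

embankedRules-classify : ∀ a b c m → 1 ≤ m → m < length (embankedRules a b c) →
  ruleAt (embankedRules a b c) m ≡ increment ⊎
  (ruleAt (embankedRules a b c) m ≡ halve × (m ≡ suc a ⊎ m ≡ suc (a + suc b)))
embankedRules-classify a b c (suc m) _ lt with ruleAt-incs-++ a (halve ∷ (incs b ++ halve ∷ incs c)) m
... | inj₁ inc                   = inj₁ inc
... | inj₂ (zero , refl , at)    = inj₂ (at , inj₁ (cong suc (+-identityʳ a)))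
... | inj₂ (suc k , refl , at) with ruleAt-incs-++ b (halve ∷ incs c) k
...   | inj₁ inc                 = inj₁ (trans at inc)
...   | inj₂ (zero , refl , at′) = inj₂ (trans at at′ , inj₂ (cong (λ j → suc (a + suc j)) (+-identityʳ b)))
...   | inj₂ (suc j , refl , at′) = inj₁ (trans at (trans at′ (ruleAt-incs c j j<c)))
  where
  j<c : j < c
  j<c = ≤-pred (+-cancelˡ-< b (suc j) (suc c) (≤-pred (+-cancelˡ-< a (suc (b + suc j)) (suc (b + suc c))
          (≤-pred (subst (suc (suc (a + suc (b + suc j))) ≤_) (length-embankedRules a b c) lt)))))

ruleAt-incs-++-+ : ∀ n ys k → ruleAt (incs n ++ ys) (n + k) ≡ ruleAt ys k
ruleAt-incs-++-+ zero    ys k = refl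
ruleAt-incs-++-+ (suc n) ys k = ruleAt-incs-++-+ n ys k

ruleAt-p : ∀ a b c → ruleAt (embankedRules a b c) (suc a) ≡ halve
ruleAt-p a b c = trans (cong (ruleAt (incs a ++ _)) (sym (+-identityʳ a))) (ruleAt-incs-++-+ a _ 0)

ruleAt-q : ∀ a b c → ruleAt (embankedRules a b c) (suc (a + suc b)) ≡ halve
ruleAt-q a b c = trans (ruleAt-incs-++-+ a _ (suc b))
                       (trans (cong (ruleAt (incs b ++ _)) (sym (+-identityʳ b))) (ruleAt-incs-++-+ b _ 0))

moving-embankedRules : ∀ a b c m → 1 ≤ m → m < length (embankedRules a b c) →
                       HalveOrIncrement (ruleAt (embankedRules a b c) m)
moving-embankedRules a b c m 1≤m lt with embankedRules-classify a b c m 1≤m lt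
... | inj₁ inc       = subst HalveOrIncrement (sym inc) is-increment
... | inj₂ (hal , _) = subst HalveOrIncrement (sym hal) is-halve

OnlyHalvesAt : State → ℕ → ℕ → Set
OnlyHalvesAt E p q = ∀ m r → 1 ≤ m → TRule E m r → (r ≡ increment) ⊎ ((r ≡ halve) × ((m ≡ p) ⊎ (m ≡ q)))

Run⇒Embanked×NextEmpty : ∀ {F T} a b c → Run F (embankedRules a b c) T → Empty F → Empty T →
                         Embanked F × NextEmpty F T
Run⇒Embanked×NextEmpty {F} {T} a b c run emptyF emptyT = embanked , nextEmpty
  where
  J : ℕ
  J = length (embankedRules a b c)
  noEmpty : ∀ j G → 1 ≤ j → j < J → iter j F ≡ just G → ¬ Empty G
  noEmpty j G 1≤j j<J it with Run-at run j j<J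
  ... | H , itH , r = moving⇒¬Empty G (subst HalveOrIncrement (sym (trans (cong rule (same-state j F it itH)) r))
                                              (moving-embankedRules a b c j 1≤j j<J))
  nextEmpty : NextEmpty F T
  nextEmpty = J , s≤s z≤n , Run⇒iter run , emptyT , noEmpty
  tRule : ∀ m → m < J → TRule F m (ruleAt (embankedRules a b c) m)
  tRule m m<J with Run-at run m m<J
  ... | G , it , r = G , it , (λ j H 1≤j j≤m → noEmpty j H 1≤j (≤-<-trans j≤m m<J)) , r
  p<J : suc a < J
  p<J = subst (suc a <_) (sym (length-embankedRules a b c)) (s≤s (m<m+n a z<s))
  q<J : suc (a + suc b) < J
  q<J = subst (suc (a + suc b) <_) (sym (length-embankedRules a b c)) (s≤s (+-monoʳ-< a (s≤s (m<m+n b z<s))))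
  halveAt : ∀ m → m < J → ruleAt (embankedRules a b c) m ≡ halve → TRule F m halve
  halveAt m m<J hal with tRule m m<J
  ... | G , it , nu , r = G , it , nu , trans r hal
  classify : OnlyHalvesAt F (suc a) (suc (a + suc b))
  classify m r 1≤m (G , it , nu , rG) with m <? J
  ... | no m≮J = ⊥-elim (nu J T (s≤s z≤n) (≮⇒≥ m≮J) (Run⇒iter run) emptyT)
  ... | yes m<J with Run-at run m m<J
  ...   | H , itH , rH with trans (sym rG) (trans (cong rule (same-state m F it itH)) rH)
  ...     | r≡ = Data.Sum.map (trans r≡) (Data.Product.map₁ (trans r≡)) (embankedRules-classify a b c m 1≤m m<J)
  embanked : Embanked F
  embanked = emptyF , (F , refl , (λ j G 1≤j j≤0 → ⊥-elim (<⇒≱ 1≤j j≤0)) , Empty⇒zeroR F emptyF) ,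
             (suc a , suc (a + suc b) , s≤s (m<m+n a z<s) ,
              halveAt (suc a) p<J (ruleAt-p a b c) , halveAt (suc (a + suc b)) q<J (ruleAt-q a b c) , classify)

incrementsFrom : ∀ E d m {G H} → iter m E ≡ just G → iter (d + m) E ≡ just H →
                 (∀ t K → m ≤ t → t < d + m → iter t E ≡ just K → rule K ≡ increment) → Increments G d H
incrementsFrom E zero    m itG itH _ = subst (Increments _ 0) (same-state m E itG itH) done
incrementsFrom E (suc d) m {G} itG itH increments =
  step incrementG (incrementsFrom E d (suc m) itG′ (trans (cong (λ k → iter k E) (+-suc d m)) itH) increments′)
  where
  incrementG : rule G ≡ increment
  incrementG = increments m G ≤-refl (s≤s (m≤n+m m d)) itG
  itG′ : iter (suc m) E ≡ just (incrementS G)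
  itG′ = trans (iter-suc-just m E G itG) (P-increment G incrementG)
  increments′ : ∀ t K → suc m ≤ t → t < d + suc m → iter t E ≡ just K → rule K ≡ increment
  increments′ t K m<t t< = increments t K (<⇒≤ m<t) (subst (t <_) (+-suc d m) t<)

incrementsBetween : ∀ E m n {G H} → m ≤ n → iter m E ≡ just G → iter n E ≡ just H →
                    (∀ t K → m ≤ t → t < n → iter t E ≡ just K → rule K ≡ increment) →
                    Increments G (n ∸ m) H
incrementsBetween E m n m≤n itG itH increments =
  incrementsFrom E (n ∸ m) m itG (trans (cong (λ k → iter k E) (m∸n+n≡m m≤n)) itH)
    (λ t K m≤t t< → increments t K m≤t (subst (t <_) (m∸n+n≡m m≤n) t<))

record EmbankedRun (E F : State) (h₁ h₂ : ℕ) : Set where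
  field
    a b c   : ℕ
    X₁ X₂   : State
    zero-E  : rule E ≡ zeroR
    run₁    : Increments (zeroS E) a X₁
    halve₁  : rule X₁ ≡ halve
    run₂    : Increments (halveS X₁) b X₂
    halve₂  : rule X₂ ≡ halve
    run₃    : Increments (halveS X₂) c F
    isN₁    : IsN (halveS X₁) h₁
    isN₂    : IsN (halveS X₂) h₂
    evenSum : isOdd (sumℤ E) ≡ false

TRule-halve⇒1≤ : ∀ {E m} → rule E ≡ zeroR → TRule E m halve → 1 ≤ m
TRule-halve⇒1≤ {m = zero}  zero-E (_ , it , _ , r) with trans (sym zero-E) (trans (cong rule (just-injective it)) r)
... | ()
TRule-halve⇒1≤ {m = suc m} _      _ = s≤s z≤n

firstTwoHalves : ∀ {E p q p₀ q₀} → rule E ≡ zeroR → OnlyHalvesAt E p q → p < q → p₀ < q₀ →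
                 TRule E p₀ halve → TRule E q₀ halve → p₀ ≡ p × q₀ ≡ q
firstTwoHalves {E} {p} {q} {p₀} {q₀} zero-E classify p<q p₀<q₀ tp₀ tq₀ = p₀≡p , q₀≡q
  where
  halveAt : ∀ m → TRule E m halve → m ≡ p ⊎ m ≡ q
  halveAt m t with classify m halve (TRule-halve⇒1≤ zero-E t) t
  ... | inj₂ (_ , m≈) = m≈
  p₀≡p : p₀ ≡ p
  p₀≡p with halveAt p₀ tp₀ | halveAt q₀ tq₀
  ... | inj₁ p₀≡p | _         = p₀≡p
  ... | inj₂ refl | inj₁ refl = ⊥-elim (<-asym p<q p₀<q₀)
  ... | inj₂ refl | inj₂ refl = ⊥-elim (<-irrefl refl p₀<q₀)
  q₀≡q : q₀ ≡ q
  q₀≡q with halveAt q₀ tq₀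
  ... | inj₂ q₀≡q = q₀≡q
  ... | inj₁ refl = ⊥-elim (<-irrefl p₀≡p p₀<q₀)

embankedRun : ∀ {E F h₁ h₂} → Embanked E → NextEmpty E F → HVal E h₁ h₂ → EmbankedRun E F h₁ h₂
embankedRun {E} {F} {h₁} {h₂}
  ((_ , σ≡ , _) , (_ , it₀ , _ , r₀) , p , q , p<q , (X₁ , itp , nop , rp) , (X₂ , itq , noq , rq) , classify)
  (J , 1≤J , itJ , emptyF , noEmpty)
  (p₀ , q₀ , (p₀<q₀ , tp₀ , tq₀ , _) , G₁ , G₂ , it₁ , it₂ , isN₁ , isN₂) = record
  { a = p ∸ 1 ; b = q ∸ suc p ; c = J ∸ suc q ; X₁ = X₁ ; X₂ = X₂ ; zero-E = zero-E
  ; run₁ = incrementsBetween E 1 p 1≤p (P-zeroR E zero-E) itp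
             (λ t K 1≤t t<p → incrementAt t K 1≤t (<-trans t<p p<J) (<⇒≢ t<p) (<⇒≢ (<-trans t<p p<q)))
  ; halve₁ = rp
  ; run₂ = incrementsBetween E (suc p) q p<q (afterHalve p X₁ itp rp) itq
             (λ t K p<t t<q → incrementAt t K (≤-trans (s≤s z≤n) p<t) (<-trans t<q q<J) (>⇒≢ p<t) (<⇒≢ t<q))
  ; halve₂ = rq
  ; run₃ = incrementsBetween E (suc q) J q<J (afterHalve q X₂ itq rq) itJ
             (λ t K q<t t<J → incrementAt t K (≤-trans (s≤s z≤n) q<t) t<J (>⇒≢ (<-trans p<q q<t)) (>⇒≢ q<t))
  ; isN₁ = subst (λ X → IsN X h₁)
             (same-state (suc p₀) E it₁ (trans (cong (λ k → iter (suc k) E) (proj₁ positions)) (afterHalve p X₁ itp rp))) isN₁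
  ; isN₂ = subst (λ X → IsN X h₂)
             (same-state (suc q₀) E it₂ (trans (cong (λ k → iter (suc k) E) (proj₂ positions)) (afterHalve q X₂ itq rq))) isN₂
  ; evenSum = σ≡-1⇒even E σ≡
  }
  where
  zero-E : rule E ≡ zeroR
  zero-E = trans (cong rule (just-injective it₀)) r₀
  before-J : ∀ {m} → NoEmptyUpTo E m → m < J
  before-J {m} noneUpTo with m <? J
  ... | yes m<J = m<J
  ... | no m≮J  = ⊥-elim (noneUpTo J F 1≤J (≮⇒≥ m≮J) itJ emptyF)
  p<J : p < J
  p<J = before-J nop
  q<J : q < J
  q<J = before-J noq
  afterHalve : ∀ m X → iter m E ≡ just X → rule X ≡ halve → iter (suc m) E ≡ just (halveS X)
  afterHalve m X it r = trans (iter-suc-just m E X it) (P-halve X r)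
  1≤p : 1 ≤ p
  1≤p = TRule-halve⇒1≤ zero-E (X₁ , itp , nop , rp)
  incrementAt : ∀ t K → 1 ≤ t → t < J → t ≢ p → t ≢ q → iter t E ≡ just K → rule K ≡ increment
  incrementAt t K 1≤t t<J t≢p t≢q it
    with classify t (rule K) 1≤t (K , it , (λ j G 1≤j j≤t → noEmpty j G 1≤j (≤-<-trans j≤t t<J)) , refl)
  ... | inj₁ inc                = inc
  ... | inj₂ (_ , inj₁ t≡p)     = ⊥-elim (t≢p t≡p)
  ... | inj₂ (_ , inj₂ t≡q)     = ⊥-elim (t≢q t≡q)
  positions : p₀ ≡ p × q₀ ≡ q
  positions = firstTwoHalves zero-E classify p<q p₀<q₀ tp₀ tq₀

-- Shadowing

x+[1+n]≢-1 : ∀ x n → -1ℤ ≤ℤ x → x +ℤ + suc n ≢ -1ℤ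
x+[1+n]≢-1 (+ m)        n _        ()
x+[1+n]≢-1 -[1+ zero ]  n _        ()
x+[1+n]≢-1 -[1+ suc m ] n (-≤- ()) _

head-bump≢-1 : ∀ j S → AtLeast-1 S → rule S ≡ increment → entry (bump j S) 0 ≢ -1ℤ
head-bump≢-1 zero    (x ∷ xs) (-1≤x ∷ _) _ = x+[1+n]≢-1 x 1 -1≤x
head-bump≢-1 (suc j) S        _          r =
  subst (_≢ -1ℤ) (sym (head-addAt-suc j (+ 2) S)) (proj₂ (rule≡increment⇒ S r))

mirrorIncrements : ∀ j {S n T} → AtLeast-1 S → Increments S n T → Increments (bump j S) n (bump j T)
mirrorIncrements j     ok done         = done
mirrorIncrements j {S} ok (step r run) =
  step increment′ (subst (λ X → Increments X _ _) (sym (incrementS-bump S j))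
                         (mirrorIncrements j (incrementS-AtLeast-1 S r ok) run))
  where
  increment′ : rule (bump j S) ≡ increment
  increment′ = trans (moving-resp-parities S (bump j S) (subst HalveOrIncrement (sym r) is-increment)
                                            (sym (parities-bump j S)))
                     (halveIfMinusOne-increment (bump j S) (head-bump≢-1 j S ok r))

mirrorHalve : ∀ j X {n T} → rule X ≡ halve → AtLeast-1 (halveS X) → Increments (halveS X) n T →
              rule (bump (suc j) X) ≡ halve × Increments (halveS (bump (suc j) X)) n (bump j T)
mirrorHalve j X r ok run = halve′ , subst (λ S → Increments S _ _) (sym (halveS-bump X j)) (mirrorIncrements j ok run)
  where
  halve′ : rule (bump (suc j) X) ≡ halve
  halve′ = trans (moving-resp-parities X (bump (suc j) X) (subst HalveOrIncrement (sym r) is-halve)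
                                        (sym (parities-bump (suc j) X)))
                 (halveIfMinusOne-halve (bump (suc j) X) (trans (head-addAt-suc j (+ 2) X) (proj₂ (rule≡halve⇒ X r))))

mirrorZero : ∀ j S {n T} → 2 ≤ length S → j < length S → AtLeast-1 (zeroS S) → Increments (zeroS S) n T →
             Increments (zeroS (bump j S)) n (bump j T)
mirrorZero j S len j< ok run = subst (λ X → Increments X _ _) (sym (zeroS-bump S j len j<)) (mirrorIncrements j ok run)

Run-embanked : ∀ {S X₁ X₂ T} a b c → rule S ≡ zeroR → Increments (zeroS S) a X₁ → rule X₁ ≡ halve →
               Increments (halveS X₁) b X₂ → rule X₂ ≡ halve → Increments (halveS X₂) c T →
               Run S (embankedRules a b c) T
Run-embanked {S} {X₁} {X₂} a b c z run₁ h₁ run₂ h₂ run₃ =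
  (z , P-zeroR S z) ∷ Run-++ (Increments⇒Run run₁) ((h₁ , P-halve X₁ h₁) ∷
  Run-++ (Increments⇒Run run₂) ((h₂ , P-halve X₂ h₂) ∷ Increments⇒Run run₃))

desync : ∀ Y → rule (-1ℤ ∷ Y) ≡ halve → rule (1ℤ ∷ Y) ≡ increment
desync Y r = trans (moving-resp-parities (-1ℤ ∷ Y) (1ℤ ∷ Y) (subst HalveOrIncrement (sym r) is-halve) refl)
                   (halveIfMinusOne-increment (1ℤ ∷ Y) (λ ()))

rejoin : State → State
rejoin Y = addAt (suc (resyncIndex Y)) 1ℤ (addAt 0 1ℤ Y)

record Detour (Y : State) : Set where
  field
    resync<length : suc (resyncIndex Y) < length Y
    around        : Increments (1ℤ ∷ Y) 2 (-1ℤ ∷ rejoin Y)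
    halves        : rule (-1ℤ ∷ rejoin Y) ≡ halve
    back          : Increments (rejoin Y) 1 (bump (suc (resyncIndex Y)) Y)

detour : ∀ Y → rule (-1ℤ ∷ Y) ≡ halve → AtLeast-1 Y → rule (0ℤ ∷ addAt 0 1ℤ Y) ≡ increment → Detour Y
detour Y@(y ∷ ys) r (-1≤y ∷ _) r₀ = record
  { resync<length = c<
  ; around        = step (desync Y r) (step r₀ done)
  ; halves        = trans (below-top⇒rule (-1ℤ ∷ Y′) (s≤s (s≤s z≤n))) (halveIfMinusOne-halve (-1ℤ ∷ Y′) refl)
  ; back          = step increments (subst (λ X → Increments X 0 (bump (suc c) Y)) (sym incrementS-Y′) done)
  }
  where
  Y⁺ Y′ : State
  Y⁺ = addAt 0 1ℤ Y
  Y′ = rejoin Y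
  c : ℕ
  c = resyncIndex Y
  c< : suc c < length Y
  c< = ≤-pred (proj₁ (rule≡increment⇒ (0ℤ ∷ Y⁺) r₀))
  firstOdd-Y′ : firstOdd Y′ ≡ c
  firstOdd-Y′ = firstOdd-addAt-above Y⁺ (suc c) 1ℤ (<-trans (n<1+n c) c<) (n<1+n c)
  increments : rule Y′ ≡ increment
  increments = trans (below-top⇒rule Y′
                        (subst₂ _<_ (cong suc (sym firstOdd-Y′)) (sym (length-addAt (suc c) 1ℤ Y⁺)) c<))
                     (halveIfMinusOne-increment Y′ (x+[1+n]≢-1 y 0 -1≤y))
  incrementS-Y′ : incrementS Y′ ≡ bump (suc c) Y
  incrementS-Y′ = begin
    addAt 0 -1ℤ (addAt (suc (firstOdd Y′)) 1ℤ Y′)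
      ≡⟨ cong (λ k → addAt 0 -1ℤ (addAt (suc k) 1ℤ Y′)) firstOdd-Y′ ⟩
    addAt 0 -1ℤ (addAt (suc c) 1ℤ Y′)
      ≡⟨ cong (addAt 0 -1ℤ) (addAt-addAt (suc c) 1ℤ 1ℤ Y⁺) ⟩
    ((y +ℤ 1ℤ) +ℤ -1ℤ) ∷ bump c ys
      ≡⟨ cong (_∷ bump c ys) (trans (ℤ.+-assoc y 1ℤ -1ℤ) (ℤ.+-identityʳ y)) ⟩
    bump (suc c) Y ∎

AtMostOneHalve : List Rule → Set
AtMostOneHalve rs = ∀ m m′ → ruleAt rs m ≡ halve → ruleAt rs m′ ≡ halve → m ≡ m′

ruleAt-incs≢halve : ∀ n m → ruleAt (incs n) m ≢ halve
ruleAt-incs≢halve zero    m       ()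
ruleAt-incs≢halve (suc n) zero    ()
ruleAt-incs≢halve (suc n) (suc m) = ruleAt-incs≢halve n m

AtMostOneHalve-incs : ∀ n → AtMostOneHalve (zeroR ∷ incs n)
AtMostOneHalve-incs n zero    _ () _
AtMostOneHalve-incs n (suc m) _ h  _ = ⊥-elim (ruleAt-incs≢halve n m h)

AtMostOneHalve-incs-halve : ∀ a n → AtMostOneHalve (zeroR ∷ (incs a ++ halve ∷ incs n))
AtMostOneHalve-incs-halve a n m m′ h h′ = trans (onlyAt m h) (sym (onlyAt m′ h′))
  where
  onlyAt : ∀ m → ruleAt (zeroR ∷ (incs a ++ halve ∷ incs n)) m ≡ halve → m ≡ suc a
  onlyAt (suc m) h with ruleAt-incs-++ a (halve ∷ incs n) m
  ... | inj₁ inc                 = ⊥-elim (halve≢increment (trans (sym h) inc))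
    where
    halve≢increment : halve ≢ increment
    halve≢increment ()
  ... | inj₂ (zero  , refl , _)  = cong suc (+-identityʳ a)
  ... | inj₂ (suc k , refl , at) = ⊥-elim (ruleAt-incs≢halve n k (trans (sym at) h))

halve-in-Run : ∀ {F rs U m} → Run F rs U → TRule F m halve → m ≤ length rs → entry U 0 ≢ -1ℤ →
               ruleAt rs m ≡ halve
halve-in-Run {F} {rs} {U} {m} run (G , it , _ , rG) m≤ U≢-1 with m <? length rs
... | yes m< with Run-at run m m<
...   | H , itH , rH = trans (sym rH) (trans (cong rule (same-state m F itH it)) rG)
halve-in-Run {F} {rs} {U} {m} run (G , it , _ , rG) m≤ U≢-1 | no m≮ =
  ⊥-elim (U≢-1 (proj₂ (rule≡halve⇒ U halveU)))
  where
  halveU : rule U ≡ halve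
  halveU = trans (cong rule (same-state (length rs) F (Run⇒iter run)
                                         (trans (cong (λ k → iter k F) (≤-antisym (≮⇒≥ m≮) m≤)) it))) rG

-- A run from a weakly embanked state that has met at most one Halve is still before its second one.
WeaklyEmbanked⇒increment : ∀ {F rs U} → WeaklyEmbanked F → Run F rs U → 1 ≤ length rs →
                           entry U 0 ≢ -1ℤ → AtMostOneHalve rs → rule U ≡ increment
WeaklyEmbanked⇒increment {F} {rs} {U} (_ , _ , p , q , p<q , tp , tq , increments) run 1≤L U≢-1 atMostOne =
  increments L (rule U) 1≤L L<q L≢p (U , Run⇒iter run , noneUpTo , refl)
  where
  L : ℕ
  L = length rs
  L<q : L < q
  L<q with L <? q
  ... | yes L<q = L<q
  ... | no  L≮q = ⊥-elim (<-irrefl (atMostOne p q (halve-in-Run run tp (≤-trans (<⇒≤ p<q) (≮⇒≥ L≮q)) U≢-1)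
                                                   (halve-in-Run run tq (≮⇒≥ L≮q) U≢-1)) p<q)
  L≢p : L ≢ p
  L≢p L≡p = U≢-1 (proj₂ (rule≡halve⇒ U
    (trans (cong rule (same-state L F (Run⇒iter run) (trans (cong (λ k → iter k F) L≡p) (proj₁ (proj₂ tp)))))
           (proj₂ (proj₂ (proj₂ tp))))))
  noneUpTo : NoEmptyUpTo F L
  noneUpTo j G 1≤j j≤L = proj₁ (proj₂ (proj₂ tq)) j G 1≤j (≤-trans j≤L (<⇒≤ L<q))

record Shadowing (E F : State) (h₁ h₂ : ℕ) : Set where
  field
    trajectory : EmbankedRun E F h₁ h₂
    E-ok       : AtLeast-1 E
    emptyF     : Empty F
    nonnegF    : NonNegative F

shadowing : ∀ k {E F h₁ h₂} → Sk k ↦ E → Sk k ↦ F → Embanked E → NextEmpty E F → HVal E h₁ h₂ →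
            Shadowing E F h₁ h₂
shadowing k {E} {F} reachE reachF embanked next hval = record
  { trajectory = embankedRun embanked next hval
  ; E-ok       = reachable-AtLeast-1 k E reachE
  ; emptyF     = NextEmpty⇒Empty next
  ; nonnegF    = reachable-Empty⇒NonNegative k F reachF (NextEmpty⇒Empty next)
  }

module ShadowingFacts {E F h₁ h₂} (s : Shadowing E F h₁ h₂) where
  open Shadowing s public
  open EmbankedRun trajectory public

  zeroF : rule F ≡ zeroR
  zeroF = Empty⇒zeroR F emptyF

  2≤length : 2 ≤ length E
  2≤length = proj₂ (zeroR⇒allEven E zero-E)

  start₁-ok : AtLeast-1 (zeroS E)
  start₁-ok = zeroS-AtLeast-1 E zero-E E-ok

  start₂-ok : AtLeast-1 (halveS X₁)
  start₂-ok = drop⁺ 1 (Increments-AtLeast-1 start₁-ok run₁)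

  start₃-ok : AtLeast-1 (halveS X₂)
  start₃-ok = drop⁺ 1 (Increments-AtLeast-1 start₂-ok run₂)

  oddSum₂ : isOdd (sumℤ (halveS X₁)) ≡ true
  oddSum₂ = trans (isOdd-sumℤ-halveS X₁ (proj₂ (rule≡halve⇒ X₁ halve₁)))
                  (cong not (trans (sym (isOdd-sumℤ-Increments run₁)) (trans (isOdd-sumℤ-zeroS E 2≤length) evenSum)))

  evenSum₃ : isOdd (sumℤ (halveS X₂)) ≡ false
  evenSum₃ = trans (isOdd-sumℤ-halveS X₂ (proj₂ (rule≡halve⇒ X₂ halve₂)))
                   (cong not (trans (sym (isOdd-sumℤ-Increments run₂)) oddSum₂))

halve-shape : ∀ X → rule X ≡ halve → X ≡ -1ℤ ∷ halveS X
halve-shape (x ∷ xs) r = cong (_∷ xs) (proj₂ (rule≡halve⇒ (x ∷ xs) r))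

shadow-≥2 : ∀ {E h₁ h₂} i → let F = bump (2 + i) E in
             2 + i < length E → Shadowing E F h₁ h₂ → Embanked F × NextEmpty F (bump i F)
shadow-≥2 {E} i lt s = Run⇒Embanked×NextEmpty a b c run emptyF (Empty-bump F i emptyF nonnegF)
  where
  F : State
  F = bump (2 + i) E
  open ShadowingFacts s
  shadow₂ : rule (bump (2 + i) X₁) ≡ halve × Increments (halveS (bump (2 + i) X₁)) b (bump (suc i) X₂)
  shadow₂ = mirrorHalve (suc i) X₁ halve₁ start₂-ok run₂
  shadow₃ : rule (bump (suc i) X₂) ≡ halve × Increments (halveS (bump (suc i) X₂)) c (bump i F)
  shadow₃ = mirrorHalve i X₂ halve₂ start₃-ok run₃
  run : Run F (embankedRules a b c) (bump i F)
  run = Run-embanked a b c zeroF (mirrorZero (2 + i) E 2≤length lt start₁-ok run₁)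
          (proj₁ shadow₂) (proj₂ shadow₂) (proj₁ shadow₃) (proj₂ shadow₃)

shadow-0 : ∀ {E h₁ h₂} → let F = bump 0 E in
           Shadowing E F h₁ h₂ → WeaklyEmbanked F → ∃ λ v → Val2 h₁ v × Embanked F × NextEmpty F (bump v F)
shadow-0 {E} {h₁} s weak =
  v , resyncIndex-odd Y h₁ isN₁ oddSum₂ (<-trans (n<1+n v) resync<length) ,
  Run⇒Embanked×NextEmpty (a + 2) (suc b) c run emptyF (Empty-bump F v emptyF nonnegF)
  where
  F : State
  F = bump 0 E
  open ShadowingFacts s
  Y : State
  Y = halveS X₁
  halveY : rule (-1ℤ ∷ Y) ≡ halve
  halveY = subst (λ X → rule X ≡ halve) (halve-shape X₁ halve₁) halve₁
  shadow₁ : Increments (zeroS F) a (1ℤ ∷ Y)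
  shadow₁ = subst (Increments (zeroS F) a) (cong (bump 0) (halve-shape X₁ halve₁))
                  (mirrorZero 0 E 2≤length (<-trans z<s 2≤length) start₁-ok run₁)
  toDesync : Run F (zeroR ∷ incs (a + 1)) (0ℤ ∷ addAt 0 1ℤ Y)
  toDesync = (zeroF , P-zeroR F zeroF) ∷ Increments⇒Run (Increments-++ shadow₁ (step (desync Y halveY) done))
  open Detour (detour Y halveY start₂-ok
                 (WeaklyEmbanked⇒increment weak toDesync (s≤s z≤n) (λ ()) (AtMostOneHalve-incs (a + 1))))
  v : ℕ
  v = resyncIndex Y
  shadow₃ : rule (bump (suc v) X₂) ≡ halve × Increments (halveS (bump (suc v) X₂)) c (bump v F)
  shadow₃ = mirrorHalve v X₂ halve₂ start₃-ok run₃
  run : Run F (embankedRules (a + 2) (suc b) c) (bump v F)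
  run = Run-embanked (a + 2) (suc b) c zeroF (Increments-++ shadow₁ around) halves
          (Increments-++ back (mirrorIncrements (suc v) start₂-ok run₂)) (proj₁ shadow₃) (proj₂ shadow₃)

shadow-1 : ∀ {E h₁ h₂} → let F = bump 1 E in
           1 < length E → Shadowing E F h₁ h₂ → WeaklyEmbanked F →
           ∃ λ v → Val2 (suc h₂) v × Embanked F × NextEmpty F (bump (suc v) F)
shadow-1 {E} {h₁} {h₂} lt s weak =
  v , resyncIndex-even W h₂ isN₂ evenSum₃ (<-trans (n<1+n v) resync<length) ,
  Run⇒Embanked×NextEmpty a (b + 2) (suc c) run emptyF (Empty-bump F (suc v) emptyF nonnegF)
  where
  F : State
  F = bump 1 E
  open ShadowingFacts s
  W : State
  W = halveS X₂
  halveW : rule (-1ℤ ∷ W) ≡ halve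
  halveW = subst (λ X → rule X ≡ halve) (halve-shape X₂ halve₂) halve₂
  shadow₁ : Increments (zeroS F) a (bump 1 X₁)
  shadow₁ = mirrorZero 1 E 2≤length lt start₁-ok run₁
  shadow₂ : rule (bump 1 X₁) ≡ halve × Increments (halveS (bump 1 X₁)) b (bump 0 X₂)
  shadow₂ = mirrorHalve 0 X₁ halve₁ start₂-ok run₂
  shadow₂′ : Increments (halveS (bump 1 X₁)) b (1ℤ ∷ W)
  shadow₂′ = subst (Increments _ b) (cong (bump 0) (halve-shape X₂ halve₂)) (proj₂ shadow₂)
  toDesync : Run F (zeroR ∷ (incs a ++ halve ∷ incs (b + 1))) (0ℤ ∷ addAt 0 1ℤ W)
  toDesync = (zeroF , P-zeroR F zeroF) ∷ Run-++ (Increments⇒Run shadow₁)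
               ((proj₁ shadow₂ , P-halve _ (proj₁ shadow₂)) ∷
                Increments⇒Run (Increments-++ shadow₂′ (step (desync W halveW) done)))
  open Detour (detour W halveW start₃-ok
                 (WeaklyEmbanked⇒increment weak toDesync (s≤s z≤n) (λ ()) (AtMostOneHalve-incs-halve a (b + 1))))
  v : ℕ
  v = resyncIndex W
  run : Run F (embankedRules a (b + 2) (suc c)) (bump (suc v) F)
  run = Run-embanked a (b + 2) (suc c) zeroF shadow₁ (proj₁ shadow₂) (Increments-++ shadow₂′ around) halves
          (Increments-++ back (mirrorIncrements (suc v) start₃-ok run₃))

proposition3p6 : (k : ℕ) → 1 ≤ k → (E : State) → (i : ℕ) → i < length E →
    InRange k E → InRange k (bump i E) →
    Embanked E → NextEmpty E (bump i E) → WeaklyEmbanked (bump i E) →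
    (h1 h2 : ℕ) → HVal E h1 h2 →
    Embanked (bump i E) ×
    ((i ≡ 0 → ∃ λ v → Val2 h1 v × NextEmpty (bump i E) (bump v (bump i E))) ×
     (i ≡ 1 → ∃ λ v → Val2 (suc h2) v × NextEmpty (bump i E) (bump (suc v) (bump i E))) ×
     (2 ≤ i → NextEmpty (bump i E) (bump (i ∸ 2) (bump i E))))
proposition3p6 k _ E zero _ (reachE , _) (reachF , _) embanked next weak h1 h2 hval =
  let v , val , emb , nextEmpty = shadow-0 (shadowing k reachE reachF embanked next hval) weak
  in  emb , (λ _ → v , val , nextEmpty) , (λ ()) , (λ ())
proposition3p6 k _ E (suc zero) 1<len (reachE , _) (reachF , _) embanked next weak h1 h2 hval =
  let v , val , emb , nextEmpty = shadow-1 1<len (shadowing k reachE reachF embanked next hval) weak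
  in  emb , (λ ()) , (λ _ → v , val , nextEmpty) , (λ 2≤1 → ⊥-elim (1+n≰n 2≤1))
proposition3p6 k _ E (suc (suc i)) i<len (reachE , _) (reachF , _) embanked next weak h1 h2 hval =
  let emb , nextEmpty = shadow-≥2 i i<len (shadowing k reachE reachF embanked next hval)
  in  emb , (λ ()) , (λ ()) , (λ _ → nextEmpty)
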